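{- Let $S, T \subseteq \mathbb{F}_2^n$ be finite. Then $S$ and $T$ are affinely equivalent if and only if there is a cardinality-preserving linear bijection $\mathrm{Venn}(S, E(S)) \to \mathrm{Venn}(T, E(T))$.
   Context: $S,T\subseteq\mathbb{F}_2^n$ are affinely equivalent if there is an affine automorphism $f$ of $\mathbb{F}_2^n$ with $f(S)=T$. For a finite set $S$, the power set $\mathcal{P}(S)$ is an $\mathbb{F}_2$-vector space with addition the symmetric difference $X \triangle Y=(X\cup Y)\setminus(X\cap Y)$ and zero $\varnothing$. For $S\subseteq\mathbb{F}_2^n$, $E(S)\subseteq\mathcal{P}(S)$ is the collection of even zero-sum subsets of $S$: subsets of even cardinality whose elements sum to $\vec 0$ (including $\varnothing$); it is a linear subspace of $\mathcal{P}(S)$. For a linear subspace $\mathcal{V}\le\mathcal{P}(S)$ with basis $\mathscr{X}=(X_1,\dots,X_r)$ and $\vec a\in\mathbb{F}_2^r$ with support $I_{\vec a}=\{i:a_i=1\}$, the Venn region indexed by $\vec a$ is $v_{\mathscr{X}}(\vec a)=\bigcap_{i\in I_{\vec a}}X_i\cap\bigcap_{i\notin I_{\vec a}}(S\setminus X_i)$ (regions with distinct indices are regarded as distinct, even if empty). $\mathrm{Venn}(S,\mathcal{V})$ denotes this indexed family of Venn regions, made into an $r$-dimensional $\mathbb{F}_2$-vector space by $v_{\mathscr{X}}(\vec a)+v_{\mathscr{X}}(\vec b)=v_{\mathscr{X}}(\vec a+\vec b)$. A cardinality-preserving linear bijection $\mathrm{Venn}(S,\mathcal{V})\to\mathrm{Venn}(T,\mathcal{W})$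 means: for bases $\mathscr{X}$ of $\mathcal{V}$ and $\mathscr{Y}$ of $\mathcal{W}$ (both of size $r$), an invertible $r\times r$ matrix $N$ over $\mathbb{F}_2$ with $|v_{\mathscr{Y}}(N\vec a)|=|v_{\mathscr{X}}(\vec a)|$ for all $\vec a\in\mathbb{F}_2^r$ (the existence of such $N$ does not depend on the choice of bases). -}

module Defs where

open import Data.Bool using (Bool; true; false; _∧_; _xor_; if_then_else_)
open import Data.Nat using (ℕ; zero; suc)
open import Data.Nat.Divisibility using (_∣_)
open import Data.Fin using (Fin; zero; suc; _≟_)
open import Data.Vec using (Vec; []; _∷_; lookup; tabulate; zipWith; replicate)
open import Data.List using (List; []; _∷_; map; _++_; [_])
open import Data.Product using (Σ; _×_; ∃)
open import Function.Bundles using (_⇔_)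
open import Relation.Binary.PropositionalEquality using (_≡_)
open import Relation.Nullary using (does)

-- F₂ = Bool (xor = addition, ∧ = multiplication); F₂ⁿ = Vec Bool n.

Pt : ℕ → Set
Pt n = Vec Bool n

_⊕_ : ∀ {n} → Pt n → Pt n → Pt n
_⊕_ = zipWith _xor_

𝟎 : ∀ n → Pt n
𝟎 n = replicate n false

allPts : ∀ n → List (Pt n)
allPts zero    = [ [] ]
allPts (suc n) = map (true ∷_) (allPts n) ++ map (false ∷_) (allPts n)

xorSum : ∀ r → (Fin r → Bool) → Bool
xorSum zero    f = false
xorSum (suc r) f = f zero xor xorSum r (λ i → f (suc i))

andAll : ∀ r → (Fin r → Bool) → Bool
andAll zero    f = true
andAll (suc r) f = f zero ∧ andAll r (λ i → f (suc i))

-- Subsets of F₂ⁿ as characteristic functions (F₂ⁿ is finite, so every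
-- subset is finite). Equality of subsets is pointwise.

Subset : ℕ → Set
Subset n = Pt n → Bool

_⊆_ : ∀ {n} → Subset n → Subset n → Set
X ⊆ S = ∀ x → X x ≡ true → S x ≡ true

_≐_ : ∀ {n} → Subset n → Subset n → Set
X ≐ Y = ∀ x → X x ≡ Y x

countL : ∀ {A : Set} → List A → (A → Bool) → ℕ
countL []       P = zero
countL (a ∷ as) P = if P a then suc (countL as P) else countL as P

card : ∀ {n} → Subset n → ℕ
card {n} X = countL (allPts n) X

sumL : ∀ {n} → List (Pt n) → Subset n → Pt n
sumL {n} []       X = 𝟎 n
sumL {n} (x ∷ xs) X = if X x then x ⊕ sumL xs X else sumL xs X

setSum : ∀ {n} → Subset n → Pt n
setSum {n} X = sumL (allPts n) X

InE : ∀ {n} → Subset n → Subset n → Set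
InE {n} S X = (X ⊆ S) × (2 ∣ card X) × (setSum X ≡ 𝟎 n)

comb : ∀ {n r} → (Fin r → Subset n) → (Fin r → Bool) → Subset n
comb {n} {r} X c x = xorSum r (λ i → c i ∧ X i x)

IsBasisE : ∀ {n r} → Subset n → (Fin r → Subset n) → Set
IsBasisE {n} {r} S X =
  (∀ i → InE S (X i)) ×
  (∀ (c : Fin r → Bool) → comb X c ≐ (λ _ → false) → ∀ i → c i ≡ false) ×
  (∀ (Y : Subset n) → InE S Y → Σ (Fin r → Bool) λ c → comb X c ≐ Y)

venn : ∀ {n r} → Subset n → (Fin r → Subset n) → (Fin r → Bool) → Subset n
venn {n} {r} S X a x = S x ∧ andAll r (λ i → does (Data.Bool._≟_ (X i x) (a i)))
  where import Data.Bool

Mat : ℕ → Set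
Mat r = Fin r → Fin r → Bool

_·_ : ∀ {r} → Mat r → Mat r → Mat r
_·_ {r} A B i j = xorSum r (λ k → A i k ∧ B k j)

idMat : ∀ {r} → Mat r
idMat i j = does (i ≟ j)

Invertible : ∀ {r} → Mat r → Set
Invertible {r} A = Σ (Mat r) λ B → (∀ i j → (A · B) i j ≡ idMat i j)
                                  × (∀ i j → (B · A) i j ≡ idMat i j)

mulVec : ∀ {r} → Mat r → (Fin r → Bool) → (Fin r → Bool)
mulVec {r} A a i = xorSum r (λ j → A i j ∧ a j)

affineMap : ∀ {n} → Mat n → Pt n → Pt n → Pt n
affineMap {n} A b x = tabulate (λ i → xorSum n (λ j → A i j ∧ lookup x j)) ⊕ b

ImageIs : ∀ {n} → (Pt n → Pt n) → Subset n → Subset n → Set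
ImageIs {n} f S T = ∀ (y : Pt n) → (T y ≡ true) ⇔ (Σ (Pt n) λ x → (S x ≡ true) × (f x ≡ y))

AffinelyEquivalent : ∀ {n} → Subset n → Subset n → Set
AffinelyEquivalent {n} S T =
  Σ (Mat n) λ A → Σ (Pt n) λ b → Invertible A × ImageIs (affineMap A b) S T

CardPresVennBij : ∀ {n} → Subset n → Subset n → Set
CardPresVennBij {n} S T =
  Σ ℕ λ r → Σ (Fin r → Subset n) λ X → Σ (Fin r → Subset n) λ Y → Σ (Mat r) λ N →
    IsBasisE S X × IsBasisE T Y × Invertible N ×
    (∀ (a : Fin r → Bool) → card (venn T Y (mulVec N a)) ≡ card (venn S X a))

{-# OPTIONS --safe #-}
-- Enumerate S as u₁ … uₘ. A subset of S is then a coefficient vector c ∈ F₂ᵐ, and it is an even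
-- zero-sum set exactly when c is an affine relation of the uₖ: Σ cₖ = 0 and Σ cₖ uₖ = 0. So if S
-- and T have enumerations u and w with the same affine relations, one basis of that relation
-- space gives bases of E(S) and E(T) whose Venn regions are the images under u and w of the same
-- index sets, and the identity matrix preserves cardinalities. Such enumerations exist when S and
-- T are affinely equivalent (take w = f ∘ u), and conversely they force affine equivalence: after
-- moving u₀ and w₀ to the origin the two families have the same linear relations, and a linear
-- automorphism carrying one onto the other is built coordinate by coordinate from shears and
-- transvections.
-- Finally, a cardinality-preserving N makes the Venn regions of S and T indexed by a and N a
-- equinumerous, so S and T can be enumerated in parallel, region by region. Writing an even
-- zero-sum subset of S in the basis X and transporting its coefficients through N⁻¹ exhibits the
-- corresponding subset of T as a combination of the Yⱼ; hence these enumerations, too, have the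
-- same affine relations.
module Submission where

open import Defs

open import Algebra.Bundles using (AbelianGroup; CommutativeRing)
open import Algebra.Structures using (IsAbelianGroup)
import Algebra.Properties.CommutativeSemigroup as CommSemigroupProperties
import Algebra.Properties.Group as GroupProperties
open import Data.Bool using (Bool; true; false; _∧_; _xor_; not; if_then_else_)
import Data.Bool as Bool
open import Data.Bool.Properties
  using (xor-assoc; xor-comm; xor-identityʳ; xor-same; ∧-distribˡ-xor; ∧-distribʳ-xor; ∧-comm; ∧-assoc;
         ∧-zeroʳ; ∧-identityʳ; ∧-conicalˡ; not-involutive; xor-∧-commutativeRing)
open import Data.Empty using (⊥; ⊥-elim)
open import Data.Fin using (Fin; zero; suc)
open import Data.Fin.Properties using (_≟_; any?) renaming (suc-injective to Fin-suc-injective)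
open import Data.List using (List; []; _∷_; map; _++_; filter) renaming (lookup to lookupL)
open import Data.List.Membership.Propositional using (_∈_)
open import Data.List.Membership.Propositional.Properties
  using (∈-map⁺; ∈-map⁻; ∈-++⁺ˡ; ∈-++⁺ʳ; ∈-lookup; ∈-filter⁺; ∈-filter⁻; ∈-∃++)
open import Data.List.Properties using (map-id)
open import Data.List.Relation.Binary.Permutation.Propositional as ↭ using (_↭_; ↭-sym; ↭⇒↭ₛ)
open import Data.List.Relation.Binary.Permutation.Propositional.Properties using (shift; ∈-resp-↭)
import Data.List.Relation.Binary.Permutation.Setoid.Properties as ↭ₛ
open import Data.List.Relation.Unary.All as All using (All; []; _∷_)
open import Data.List.Relation.Unary.AllPairs using ([]; _∷_)
open import Data.List.Relation.Unary.Any as Any using (here; there; satisfied)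
open import Data.List.Relation.Unary.Any.Properties using (lookup-index)
open import Data.List.Relation.Unary.Unique.Propositional using (Unique)
import Data.List.Relation.Unary.Unique.Propositional.Properties as Unique
open import Data.Nat using (ℕ; zero; suc; _+_; _*_)
open import Data.Nat.Divisibility using (_∣_; divides)
open import Data.Nat.Properties using (+-suc; suc-injective)
open import Data.Product using (Σ; ∃; _×_; _,_; proj₁; proj₂)
open import Data.Vec using ([]; _∷_; head; tail; lookup; tabulate)
open import Data.Vec.Functional using () renaming (_∷_ to _◂_)
open import Data.Vec.Properties
  using (∷-injective; ∷-injectiveʳ; lookup-zipWith; lookup-replicate; ≡-dec; tabulate∘lookup; lookup∘tabulate;
         tabulate-cong)
open import Data.Vec.Relation.Binary.Pointwise.Inductive
  using (Pointwise-≡⇒≡; zipWith-assoc; zipWith-comm; zipWith-identityˡ)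
open import Function using (id; _∘_; _↔_; Inverse; mk↔ₛ′; case_of_)
open import Function.Bundles using (_⇔_; mk⇔; Equivalence)
open import Function.Construct.Composition using (_↔-∘_; _⇔-∘_)
open import Function.Construct.Identity using (↔-id)
open import Function.Construct.Symmetry using (↔-sym; ⇔-sym)
open import Level using (0ℓ)
open import Relation.Binary.Definitions using (DecidableEquality)
open import Relation.Binary.PropositionalEquality
open import Relation.Nullary using (Dec; yes; no; does; ¬_; ¬?)
import Relation.Nullary.Decidable as Dec
open import Relation.Nullary.Decidable using (decidable-stable; dec-true; dec-false; does-⇔)

private
  variable
    m n r : ℕ

xor-interchange : ∀ a b c d → (a xor b) xor (c xor d) ≡ (a xor c) xor (b xor d)
xor-interchange = CommSemigroupProperties.interchange
  (CommutativeRing.+-commutativeSemigroup xor-∧-commutativeRing)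

open GroupProperties (CommutativeRing.+-group xor-∧-commutativeRing)
  using () renaming (\\-leftDividesʳ to xor-cancelˡ; //-rightDividesʳ to xor-cancelʳ)

xorSum-cong : {f g : Fin r → Bool} → (∀ i → f i ≡ g i) → xorSum r f ≡ xorSum r g
xorSum-cong {zero}  f≗g = refl
xorSum-cong {suc r} f≗g = cong₂ _xor_ (f≗g zero) (xorSum-cong (f≗g ∘ suc))

xorSum-zero : {f : Fin r → Bool} → (∀ i → f i ≡ false) → xorSum r f ≡ false
xorSum-zero {zero}  f≗0 = refl
xorSum-zero {suc r} f≗0 rewrite f≗0 zero = xorSum-zero (f≗0 ∘ suc)

xorSum-distrib-xor : ∀ r (f g : Fin r → Bool) →
  xorSum r (λ i → f i xor g i) ≡ xorSum r f xor xorSum r g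
xorSum-distrib-xor zero    f g = refl
xorSum-distrib-xor (suc r) f g = begin
  (f zero xor g zero) xor xorSum r (λ i → f (suc i) xor g (suc i))
    ≡⟨ cong ((f zero xor g zero) xor_) (xorSum-distrib-xor r (f ∘ suc) (g ∘ suc)) ⟩
  (f zero xor g zero) xor (xorSum r (f ∘ suc) xor xorSum r (g ∘ suc))
    ≡⟨ xor-interchange (f zero) (g zero) _ _ ⟩
  (f zero xor xorSum r (f ∘ suc)) xor (g zero xor xorSum r (g ∘ suc)) ∎
  where open ≡-Reasoning

∧-distribˡ-xorSum : ∀ r b (f : Fin r → Bool) → b ∧ xorSum r f ≡ xorSum r (λ i → b ∧ f i)
∧-distribˡ-xorSum zero    b f = ∧-zeroʳ b
∧-distribˡ-xorSum (suc r) b f =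
  trans (∧-distribˡ-xor b (f zero) _) (cong ((b ∧ f zero) xor_) (∧-distribˡ-xorSum r b (f ∘ suc)))

xorSum-comm : ∀ m r (f : Fin m → Fin r → Bool) →
  xorSum m (λ i → xorSum r (f i)) ≡ xorSum r (λ j → xorSum m (λ i → f i j))
xorSum-comm zero    r f = sym (xorSum-zero {r} λ _ → refl)
xorSum-comm (suc m) r f =
  trans (cong (xorSum r (f zero) xor_) (xorSum-comm m r (f ∘ suc)))
        (sym (xorSum-distrib-xor r (f zero) _))

xorSum-∧-assoc : ∀ r m (a : Fin r → Bool) (B : Fin r → Fin m → Bool) (c : Fin m → Bool) →
  xorSum r (λ i → a i ∧ xorSum m (λ k → B i k ∧ c k)) ≡
  xorSum m (λ k → xorSum r (λ i → a i ∧ B i k) ∧ c k)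
xorSum-∧-assoc r m a B c = begin
  xorSum r (λ i → a i ∧ xorSum m (λ k → B i k ∧ c k))
    ≡⟨ xorSum-cong (λ i → ∧-distribˡ-xorSum m (a i) _) ⟩
  xorSum r (λ i → xorSum m (λ k → a i ∧ (B i k ∧ c k)))
    ≡⟨ xorSum-comm r m _ ⟩
  xorSum m (λ k → xorSum r (λ i → a i ∧ (B i k ∧ c k)))
    ≡⟨ xorSum-cong (λ k → xorSum-cong (λ i → trans (sym (∧-assoc (a i) _ _)) (∧-comm _ (c k)))) ⟩
  xorSum m (λ k → xorSum r (λ i → c k ∧ (a i ∧ B i k)))
    ≡⟨ xorSum-cong (λ k → trans (sym (∧-distribˡ-xorSum r (c k) _)) (∧-comm (c k) _)) ⟩
  xorSum m (λ k → xorSum r (λ i → a i ∧ B i k) ∧ c k) ∎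
  where open ≡-Reasoning

_⊙_ : (Fin m → Bool) → (Fin m → Bool) → Bool
_⊙_ {m} c γ = xorSum m (λ j → c j ∧ γ j)

xorSum-idMat : ∀ r (f : Fin r → Bool) j → xorSum r (λ k → idMat j k ∧ f k) ≡ f j
xorSum-idMat (suc r) f zero    = trans (cong (f zero xor_) (xorSum-zero {r} λ _ → refl)) (xor-identityʳ _)
xorSum-idMat (suc r) f (suc j) = xorSum-idMat r (f ∘ suc) j

⊕-isAbelianGroup : ∀ n → IsAbelianGroup _≡_ (_⊕_ {n}) (𝟎 n) id
⊕-isAbelianGroup n = record
  { isGroup = record
    { isMonoid = record
      { isSemigroup = record
        { isMagma = record { isEquivalence = isEquivalence ; ∙-cong = cong₂ _⊕_ }
        ; assoc = λ x y z → Pointwise-≡⇒≡ (zipWith-assoc xor-assoc x y z) }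
      ; identity = (λ x → Pointwise-≡⇒≡ (zipWith-identityˡ (λ _ → refl) x))
                 , (λ x → trans (⊕-comm x _) (Pointwise-≡⇒≡ (zipWith-identityˡ (λ _ → refl) x))) }
    ; inverse = ⊕-self , ⊕-self
    ; ⁻¹-cong = id }
  ; comm = ⊕-comm }
  where
  ⊕-comm : ∀ (x y : Pt n) → x ⊕ y ≡ y ⊕ x
  ⊕-comm x y = Pointwise-≡⇒≡ (zipWith-comm xor-comm x y)
  ⊕-self : ∀ {n} (x : Pt n) → x ⊕ x ≡ 𝟎 n
  ⊕-self []      = refl
  ⊕-self (a ∷ x) = cong₂ _∷_ (xor-same a) (⊕-self x)

⊕-abelianGroup : ℕ → AbelianGroup 0ℓ 0ℓ
⊕-abelianGroup n = record { isAbelianGroup = ⊕-isAbelianGroup n }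

module _ {n : ℕ} where
  open AbelianGroup (⊕-abelianGroup n) public
    using () renaming (assoc to ⊕-assoc; comm to ⊕-comm; identityˡ to ⊕-identityˡ;
                       identityʳ to ⊕-identityʳ; inverseˡ to ⊕-self)
  open CommSemigroupProperties (AbelianGroup.commutativeSemigroup (⊕-abelianGroup n)) public
    using () renaming (interchange to ⊕-interchange)
  open GroupProperties (AbelianGroup.group (⊕-abelianGroup n)) public
    using () renaming (x∙y⁻¹≈ε⇒x≈y to ⊕≡𝟎⇒≡; //-rightDividesʳ to ⊕-cancelʳ)

_≟ᵥ_ : DecidableEquality (Pt n)
_≟ᵥ_ = ≡-dec Bool._≟_

lookup-⊕ : ∀ (x y : Pt n) i → lookup (x ⊕ y) i ≡ lookup x i xor lookup y i
lookup-⊕ x y i = lookup-zipWith _xor_ i x y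

lookup-𝟎 : ∀ (i : Fin n) → lookup (𝟎 n) i ≡ false
lookup-𝟎 i = lookup-replicate i false

lookup-ext : {x y : Pt n} → (∀ i → lookup x i ≡ lookup y i) → x ≡ y
lookup-ext {x = x} {y} eq = trans (sym (tabulate∘lookup x)) (trans (tabulate-cong eq) (tabulate∘lookup y))

infixr 25 _∙_

_∙_ : Bool → Pt n → Pt n
true  ∙ x = x
false ∙ x = 𝟎 _

lin : (Fin m → Pt n) → (Fin m → Bool) → Pt n
lin {zero}  u c = 𝟎 _
lin {suc m} u c = c zero ∙ u zero ⊕ lin (u ∘ suc) (c ∘ suc)

∙-distrib-xor : ∀ a b (x : Pt n) → (a xor b) ∙ x ≡ a ∙ x ⊕ b ∙ x
∙-distrib-xor true  true  x = sym (⊕-self x)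
∙-distrib-xor true  false x = sym (⊕-identityʳ x)
∙-distrib-xor false b     x = sym (⊕-identityˡ _)

∙-distrib-⊕ : ∀ b (x y : Pt n) → b ∙ (x ⊕ y) ≡ b ∙ x ⊕ b ∙ y
∙-distrib-⊕ true  x y = refl
∙-distrib-⊕ false x y = sym (⊕-identityˡ _)

lin-cong : (u : Fin m → Pt n) {c c′ : Fin m → Bool} → (∀ k → c k ≡ c′ k) → lin u c ≡ lin u c′
lin-cong {zero}  u c≗c′ = refl
lin-cong {suc m} u c≗c′ = cong₂ (λ b → b ∙ u zero ⊕_) (c≗c′ zero) (lin-cong (u ∘ suc) (c≗c′ ∘ suc))

lin-𝟎ᶠ : (u : Fin m → Pt n) (c : Fin m → Bool) → (∀ k → u k ≡ 𝟎 n) → lin u c ≡ 𝟎 n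
lin-𝟎ᶠ {zero}  u c u≗𝟎 = refl
lin-𝟎ᶠ {suc m} u c u≗𝟎 rewrite u≗𝟎 zero =
  trans (cong₂ _⊕_ (∙𝟎 (c zero)) (lin-𝟎ᶠ (u ∘ suc) (c ∘ suc) (u≗𝟎 ∘ suc))) (⊕-self _)
  where
  ∙𝟎 : ∀ b → b ∙ 𝟎 _ ≡ 𝟎 _
  ∙𝟎 true  = refl
  ∙𝟎 false = refl

lin-congᶠ : {u v : Fin m → Pt n} (c : Fin m → Bool) → (∀ k → u k ≡ v k) → lin u c ≡ lin v c
lin-congᶠ {zero}  c u≗v = refl
lin-congᶠ {suc m} c u≗v = cong₂ _⊕_ (cong (c zero ∙_) (u≗v zero)) (lin-congᶠ (c ∘ suc) (u≗v ∘ suc))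

lin-zero : (u : Fin m → Pt n) {c : Fin m → Bool} → (∀ k → c k ≡ false) → lin u c ≡ 𝟎 n
lin-zero {zero}  u c≗0 = refl
lin-zero {suc m} u c≗0 rewrite c≗0 zero = trans (⊕-identityˡ _) (lin-zero (u ∘ suc) (c≗0 ∘ suc))

lin-xor : (u : Fin m → Pt n) (c c′ : Fin m → Bool) →
  lin u (λ k → c k xor c′ k) ≡ lin u c ⊕ lin u c′
lin-xor {zero}  u c c′ = sym (⊕-self _)
lin-xor {suc m} u c c′ = begin
  (c zero xor c′ zero) ∙ u zero ⊕ lin (u ∘ suc) (λ k → c (suc k) xor c′ (suc k))
    ≡⟨ cong₂ _⊕_ (∙-distrib-xor (c zero) (c′ zero) (u zero)) (lin-xor (u ∘ suc) (c ∘ suc) (c′ ∘ suc)) ⟩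
  (c zero ∙ u zero ⊕ c′ zero ∙ u zero) ⊕ (lin (u ∘ suc) (c ∘ suc) ⊕ lin (u ∘ suc) (c′ ∘ suc))
    ≡⟨ ⊕-interchange _ _ _ _ ⟩
  lin u c ⊕ lin u c′ ∎
  where open ≡-Reasoning

lin-∧ : (u : Fin m → Pt n) (s : Bool) (c : Fin m → Bool) → lin u (λ k → s ∧ c k) ≡ s ∙ lin u c
lin-∧ u true  c = refl
lin-∧ u false c = lin-zero u (λ _ → refl)

lin-idMat : (u : Fin m → Pt n) (j : Fin m) → lin u (idMat j) ≡ u j
lin-idMat {suc m} u zero    = trans (cong (u zero ⊕_) (lin-zero (u ∘ suc) λ _ → refl)) (⊕-identityʳ _)
lin-idMat {suc m} u (suc j) = trans (⊕-identityˡ _) (lin-idMat (u ∘ suc) j)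

lin-translate : (u : Fin m → Pt n) (p : Pt n) (c : Fin m → Bool) →
  lin (λ k → u k ⊕ p) c ≡ lin u c ⊕ xorSum m c ∙ p
lin-translate {zero}  u p c = sym (⊕-identityˡ _)
lin-translate {suc m} u p c = begin
  c zero ∙ (u zero ⊕ p) ⊕ lin (λ k → u (suc k) ⊕ p) (c ∘ suc)
    ≡⟨ cong₂ _⊕_ (∙-distrib-⊕ (c zero) (u zero) p) (lin-translate (u ∘ suc) p (c ∘ suc)) ⟩
  (c zero ∙ u zero ⊕ c zero ∙ p) ⊕ (lin (u ∘ suc) (c ∘ suc) ⊕ xorSum m (c ∘ suc) ∙ p)
    ≡⟨ ⊕-interchange _ _ _ _ ⟩
  lin u c ⊕ (c zero ∙ p ⊕ xorSum m (c ∘ suc) ∙ p)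
    ≡⟨ cong (lin u c ⊕_) (∙-distrib-xor (c zero) _ p) ⟨
  lin u c ⊕ xorSum (suc m) c ∙ p ∎
  where open ≡-Reasoning

∙-∷ : ∀ b a (x : Pt n) → b ∙ (a ∷ x) ≡ (b ∧ a) ∷ b ∙ x
∙-∷ true  a x = refl
∙-∷ false a x = refl

lin-∷ : (u : Fin m → Pt (suc n)) (c : Fin m → Bool) →
  lin u c ≡ c ⊙ (head ∘ u) ∷ lin (tail ∘ u) c
lin-∷ {zero}  u c = refl
lin-∷ {suc m} u c with u zero
... | a ∷ x = cong₂ _⊕_ (∙-∷ (c zero) a x) (lin-∷ (u ∘ suc) (c ∘ suc))

lookup-lin : (u : Fin m → Pt n) (c : Fin m → Bool) (i : Fin n) →
  lookup (lin u c) i ≡ xorSum m (λ k → c k ∧ lookup (u k) i)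
lookup-lin {zero}  u c i = lookup-𝟎 i
lookup-lin {suc m} u c i =
  trans (lookup-⊕ (c zero ∙ u zero) _ i)
        (cong₂ _xor_ (lookup-∙ (c zero) (u zero)) (lookup-lin (u ∘ suc) (c ∘ suc) i))
  where
  lookup-∙ : ∀ b x → lookup (b ∙ x) i ≡ b ∧ lookup x i
  lookup-∙ true  x = refl
  lookup-∙ false x = lookup-𝟎 i

Additive : (Pt n → Pt m) → Set
Additive F = ∀ x y → F (x ⊕ y) ≡ F x ⊕ F y

module _ {F : Pt n → Pt m} (F-⊕ : Additive F) where

  additive-𝟎 : F (𝟎 n) ≡ 𝟎 m
  additive-𝟎 = begin
    F (𝟎 n)               ≡⟨ cong F (⊕-self (𝟎 n)) ⟨
    F (𝟎 n ⊕ 𝟎 n)         ≡⟨ F-⊕ (𝟎 n) (𝟎 n) ⟩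
    F (𝟎 n) ⊕ F (𝟎 n)     ≡⟨ ⊕-self _ ⟩
    𝟎 m ∎
    where open ≡-Reasoning

  additive-∙ : ∀ b x → F (b ∙ x) ≡ b ∙ F x
  additive-∙ true  x = refl
  additive-∙ false x = additive-𝟎

  additive-lin : ∀ {r} (u : Fin r → Pt n) c → F (lin u c) ≡ lin (F ∘ u) c
  additive-lin {zero}  u c = additive-𝟎
  additive-lin {suc r} u c =
    trans (F-⊕ _ _) (cong₂ _⊕_ (additive-∙ (c zero) (u zero)) (additive-lin (u ∘ suc) (c ∘ suc)))

-- Recursion on ℓ alone, so that dot (a ∷ ℓ) x unfolds for every x; shear, transvection and
-- liftᴸ use head and tail for the same reason.
dot : Pt n → Pt n → Bool
dot []      x = false
dot (a ∷ ℓ) x = (a ∧ head x) xor dot ℓ (tail x)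

dot-⊕ : ∀ (ℓ x y : Pt n) → dot ℓ (x ⊕ y) ≡ dot ℓ x xor dot ℓ y
dot-⊕ []      x       y       = refl
dot-⊕ (a ∷ ℓ) (b ∷ x) (c ∷ y) =
  trans (cong₂ _xor_ (∧-distribˡ-xor a b c) (dot-⊕ ℓ x y)) (xor-interchange (a ∧ b) (a ∧ c) _ _)

dot-𝟎 : ∀ (x : Pt n) → dot (𝟎 n) x ≡ false
dot-𝟎 []      = refl
dot-𝟎 (a ∷ x) = dot-𝟎 x

allPts-complete : ∀ (x : Pt n) → x ∈ allPts n
allPts-complete []          = here refl
allPts-complete (true ∷ x)  = ∈-++⁺ˡ (∈-map⁺ (true ∷_) (allPts-complete x))
allPts-complete (false ∷ x) = ∈-++⁺ʳ (map (true ∷_) (allPts _)) (∈-map⁺ (false ∷_) (allPts-complete x))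

span? : (u : Fin m → Pt n) (v : Pt n) → Dec (∃ λ c → lin u c ≡ v)
span? {m} u v = Dec.map′
  (λ found → let (x , eq) = satisfied found in lookup x , eq)
  (λ (c , eq) → Any.map (λ { refl → trans (lin-cong u (lookup∘tabulate c)) eq }) (allPts-complete (tabulate c)))
  (Any.any? (λ x → lin u (lookup x) ≟ᵥ v) (allPts m))

-- Linear automorphisms

record LinearAut (n : ℕ) : Set where
  field
    bijection : Pt n ↔ Pt n
    to-⊕      : Additive (Inverse.to bijection)

  open Inverse bijection public using (to; from; strictlyInverseˡ; strictlyInverseʳ)

  from-⊕ : Additive from
  from-⊕ x y = begin
    from (x ⊕ y)                      ≡⟨ cong from (cong₂ _⊕_ (strictlyInverseˡ x) (strictlyInverseˡ y)) ⟨
    from (to (from x) ⊕ to (from y))  ≡⟨ cong from (to-⊕ (from x) (from y)) ⟨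
    from (to (from x ⊕ from y))       ≡⟨ strictlyInverseʳ _ ⟩
    from x ⊕ from y                   ∎
    where open ≡-Reasoning

  to-injective : ∀ {x y} → to x ≡ to y → x ≡ y
  to-injective {x} {y} eq = trans (sym (strictlyInverseʳ x)) (trans (cong from eq) (strictlyInverseʳ y))

  to≡𝟎 : ∀ {x} → to x ≡ 𝟎 n → x ≡ 𝟎 n
  to≡𝟎 eq = to-injective (trans eq (sym (additive-𝟎 to-⊕)))

open LinearAut using (to; from; to-⊕; from-⊕)

idᴸ : LinearAut n
idᴸ = record { bijection = ↔-id _ ; to-⊕ = λ _ _ → refl }

_∘ᴸ_ : LinearAut n → LinearAut n → LinearAut n
G ∘ᴸ F = record
  { bijection = LinearAut.bijection G ↔-∘ LinearAut.bijection F
  ; to-⊕      = λ x y → trans (cong (to G) (to-⊕ F x y)) (to-⊕ G _ _) }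

symᴸ : LinearAut n → LinearAut n
symᴸ F = record { bijection = ↔-sym (LinearAut.bijection F) ; to-⊕ = from-⊕ F }

involutionᴸ : (f : Pt n → Pt n) → Additive f → (∀ x → f (f x) ≡ x) → LinearAut n
involutionᴸ f f-⊕ f∘f = record { bijection = mk↔ₛ′ f f f∘f f∘f ; to-⊕ = f-⊕ }

e₀ : ∀ n → Pt (suc n)
e₀ n = true ∷ 𝟎 n

head∷tail : (x : Pt (suc n)) → head x ∷ tail x ≡ x
head∷tail (a ∷ x) = refl

shear : Pt n → LinearAut (suc n)
shear v = involutionᴸ f f-⊕ f∘f
  where
  f : Pt (suc _) → Pt (suc _)
  f x = head x ∷ (tail x ⊕ head x ∙ v)
  f-⊕ : Additive f
  f-⊕ (a ∷ x) (b ∷ y) = cong ((a xor b) ∷_)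
    (trans (cong ((x ⊕ y) ⊕_) (∙-distrib-xor a b v)) (⊕-interchange x y _ _))
  f∘f : ∀ x → f (f x) ≡ x
  f∘f (a ∷ x) = cong (a ∷_) (⊕-cancelʳ (a ∙ v) x)

transvection : Pt n → LinearAut (suc n)
transvection ℓ = involutionᴸ f f-⊕ f∘f
  where
  f : Pt (suc _) → Pt (suc _)
  f x = (head x xor dot ℓ (tail x)) ∷ tail x
  f-⊕ : Additive f
  f-⊕ (a ∷ x) (b ∷ y) = cong (_∷ (x ⊕ y))
    (trans (cong ((a xor b) xor_) (dot-⊕ ℓ x y)) (xor-interchange a b _ _))
  f∘f : ∀ x → f (f x) ≡ x
  f∘f (a ∷ x) = cong (_∷ x) (xor-cancelʳ (dot ℓ x) a)

liftᴸ : LinearAut n → LinearAut (suc n)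
liftᴸ F = record
  { bijection = mk↔ₛ′ (λ x → head x ∷ to F (tail x)) (λ x → head x ∷ from F (tail x))
                      (λ { (a ∷ x) → cong (a ∷_) (LinearAut.strictlyInverseˡ F x) })
                      (λ { (a ∷ x) → cong (a ∷_) (LinearAut.strictlyInverseʳ F x) })
  ; to-⊕ = λ { (a ∷ x) (b ∷ y) → cong ((a xor b) ∷_) (to-⊕ F x y) } }

dot-witness : (v : Pt n) → v ≢ 𝟎 n → ∃ λ ℓ → dot ℓ v ≡ true
dot-witness []          v≢𝟎 = ⊥-elim (v≢𝟎 refl)
dot-witness (true ∷ v)  _   = true ∷ 𝟎 _ , cong (true xor_) (dot-𝟎 v)
dot-witness (false ∷ v) v≢𝟎 = let (ℓ , ℓv) = dot-witness v (v≢𝟎 ∘ cong (false ∷_)) in false ∷ ℓ , ℓv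

normalise : (v : Pt (suc n)) → v ≢ 𝟎 (suc n) → Σ (LinearAut (suc n)) λ H → to H v ≡ e₀ n
normalise (true ∷ v)  _   = shear v , cong (true ∷_) (⊕-self v)
normalise (false ∷ v) v≢𝟎 =
  let (ℓ , ℓv) = dot-witness v (v≢𝟎 ∘ cong (false ∷_))
  in shear v ∘ᴸ transvection ℓ
   , trans (cong (λ b → to (shear v) (b ∷ v)) ℓv) (cong (true ∷_) (⊕-self v))

-- Families with the same relations

infix 4 _⊑_ _⊑ᴬ_

_⊑_ : (u w : Fin m → Pt n) → Set
_⊑_ {n = n} u w = ∀ c → lin u c ≡ 𝟎 n → lin w c ≡ 𝟎 n

AffRel : (Fin m → Pt n) → (Fin m → Bool) → Set
AffRel {m} {n} u c = xorSum m c ≡ false × lin u c ≡ 𝟎 n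

_⊑ᴬ_ : (u w : Fin m → Pt n) → Set
u ⊑ᴬ w = ∀ c → AffRel u c → AffRel w c

Pt₀-unique : (x y : Pt 0) → x ≡ y
Pt₀-unique [] [] = refl

xor≡false⇒≡ : ∀ {a b} → a xor b ≡ false → a ≡ b
xor≡false⇒≡ {false} eq = sym eq
xor≡false⇒≡ {true}  {true} eq = refl

xorSum-axpy : ∀ r (c : Fin r → Bool) s d →
  xorSum r (λ j → c j xor (s ∧ d j)) ≡ xorSum r c xor (s ∧ xorSum r d)
xorSum-axpy r c s d =
  trans (xorSum-distrib-xor r c _) (cong (xorSum r c xor_) (sym (∧-distribˡ-xorSum r s d)))

⊙-axpy : ∀ (c : Fin m → Bool) s d γ → (λ j → c j xor (s ∧ d j)) ⊙ γ ≡ c ⊙ γ xor (s ∧ d ⊙ γ)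
⊙-axpy {m} c s d γ = trans
  (xorSum-cong λ j → trans (∧-distribʳ-xor (γ j) (c j) _) (cong ((c j ∧ γ j) xor_) (∧-assoc s (d j) (γ j))))
  (xorSum-axpy m (λ j → c j ∧ γ j) s (λ j → d j ∧ γ j))

lin-axpy : ∀ (u : Fin m → Pt n) c s d → lin u (λ j → c j xor (s ∧ d j)) ≡ lin u c ⊕ s ∙ lin u d
lin-axpy u c s d = trans (lin-xor u c _) (cong (lin u c ⊕_) (lin-∧ u s d))

⊑-aut : (H G : LinearAut n) {u w : Fin m → Pt n} → u ⊑ w → (to H ∘ u) ⊑ (to G ∘ w)
⊑-aut H G {u} {w} u⊑w c Hu≡𝟎 = begin
  lin (to G ∘ w) c  ≡⟨ additive-lin (to-⊕ G) w c ⟨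
  to G (lin w c)    ≡⟨ cong (to G) (u⊑w c (LinearAut.to≡𝟎 H (trans (additive-lin (to-⊕ H) u c) Hu≡𝟎))) ⟩
  to G (𝟎 _)        ≡⟨ additive-𝟎 (to-⊕ G) ⟩
  𝟎 _               ∎
  where open ≡-Reasoning

∙-e₀ : ∀ s → s ∷ 𝟎 n ≡ s ∙ e₀ n
∙-e₀ true  = refl
∙-e₀ false = refl

⊙-xor : ∀ (c γ δ : Fin m → Bool) → c ⊙ (λ j → γ j xor δ j) ≡ c ⊙ γ xor c ⊙ δ
⊙-xor {m} c γ δ = trans (xorSum-cong λ j → ∧-distribˡ-xor (c j) (γ j) (δ j)) (xorSum-distrib-xor m _ _)

⊙-∧ : ∀ (c : Fin m → Bool) μ α → c ⊙ (λ j → μ ∧ α j) ≡ (c ⊙ α) ∧ μ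
⊙-∧ {m} c μ α = begin
  xorSum m (λ j → c j ∧ (μ ∧ α j))   ≡⟨ xorSum-cong (λ j → trans (sym (∧-assoc (c j) μ (α j)))
                                                     (trans (cong (_∧ α j) (∧-comm (c j) μ)) (∧-assoc μ (c j) (α j)))) ⟩
  xorSum m (λ j → μ ∧ (c j ∧ α j))   ≡⟨ ∧-distribˡ-xorSum m μ _ ⟨
  μ ∧ c ⊙ α                          ≡⟨ ∧-comm μ _ ⟩
  (c ⊙ α) ∧ μ                        ∎
  where open ≡-Reasoning

-- μ is the value at e₀ of the functional to be built: forced when e₀ ∈ span u, free otherwise.
private
  headValue : (u : Fin m → Pt (suc n)) (γ : Fin m → Bool) →
    (∀ c → lin u c ≡ 𝟎 (suc n) → c ⊙ γ ≡ false) →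
    Σ Bool λ μ → ∀ c → lin (tail ∘ u) c ≡ 𝟎 n → c ⊙ γ ≡ (c ⊙ (head ∘ u)) ∧ μ
  headValue {n = n} u γ resp with span? u (e₀ n)
  ... | yes (c₀ , c₀↦e₀) = c₀ ⊙ γ , λ c ū≡𝟎 →
    let s = c ⊙ (head ∘ u)
        uc : lin u c ≡ s ∙ e₀ n
        uc = trans (lin-∷ u c) (trans (cong (s ∷_) ū≡𝟎) (∙-e₀ s))
        rel : lin u (λ j → c j xor (s ∧ c₀ j)) ≡ 𝟎 _
        rel = trans (lin-axpy u c s c₀) (trans (cong₂ _⊕_ uc (cong (s ∙_) c₀↦e₀)) (⊕-self _))
    in xor≡false⇒≡ (trans (sym (⊙-axpy c s c₀ γ)) (resp _ rel))
  ... | no e₀∉span = false , λ c ū≡𝟎 →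
    trans (resp c (headFalse c (trans (lin-∷ u c) (cong (c ⊙ (head ∘ u) ∷_) ū≡𝟎)))) (sym (∧-zeroʳ _))
    where
    headFalse : ∀ c {s} → lin u c ≡ s ∷ 𝟎 n → lin u c ≡ 𝟎 (suc n)
    headFalse c {false} eq = eq
    headFalse c {true}  eq = ⊥-elim (e₀∉span (c , eq))

functional-extension : (u : Fin m → Pt n) (γ : Fin m → Bool) →
  (∀ c → lin u c ≡ 𝟎 n → c ⊙ γ ≡ false) → ∃ λ ℓ → ∀ j → dot ℓ (u j) ≡ γ j
functional-extension {m} {zero} u γ resp =
  [] , λ j → sym (trans (sym (xorSum-idMat m γ j)) (resp (idMat j) (Pt₀-unique _ _)))
functional-extension {m} {suc n} u γ resp =
  let (μ , μ-ok) = headValue u γ resp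
      γ′ = λ j → (μ ∧ head (u j)) xor γ j
      resp′ : ∀ c → lin (tail ∘ u) c ≡ 𝟎 n → c ⊙ γ′ ≡ false
      resp′ c ū≡𝟎 = begin
        c ⊙ γ′                                             ≡⟨ ⊙-xor c (λ j → μ ∧ head (u j)) γ ⟩
        c ⊙ (λ j → μ ∧ head (u j)) xor c ⊙ γ               ≡⟨ cong₂ _xor_ (⊙-∧ c μ (head ∘ u)) (μ-ok c ū≡𝟎) ⟩
        ((c ⊙ (head ∘ u)) ∧ μ) xor ((c ⊙ (head ∘ u)) ∧ μ)  ≡⟨ xor-same ((c ⊙ (head ∘ u)) ∧ μ) ⟩
        false                                              ∎
      (ℓ , ℓ-ok) = functional-extension (tail ∘ u) γ′ resp′
  in μ ∷ ℓ , λ j → trans (cong ((μ ∧ head (u j)) xor_) (ℓ-ok j)) (xor-cancelˡ (μ ∧ head (u j)) (γ j))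
  where open ≡-Reasoning

-- After normalising uₖ = wₖ = e₀, a relation c of the tails lifts to the relation c + s δₖ of u,
-- where s = c ⊙ (head ∘ u) is the head coordinate of lin u c.
private
  tails-⊑ : ∀ k {u w : Fin m → Pt (suc n)} → u k ≡ e₀ n → w k ≡ e₀ n → u ⊑ w →
    ∀ c → lin (tail ∘ u) c ≡ 𝟎 n → lin (tail ∘ w) c ≡ 𝟎 n × c ⊙ (head ∘ u) ≡ c ⊙ (head ∘ w)
  tails-⊑ {n = n} k {u} {w} uₖ wₖ u⊑w c ū≡𝟎 =
    let s = c ⊙ (head ∘ u)
        uc : lin u c ≡ s ∙ e₀ n
        uc = trans (lin-∷ u c) (trans (cong (s ∷_) ū≡𝟎) (∙-e₀ s))
        rel : lin w (λ j → c j xor (s ∧ idMat k j)) ≡ 𝟎 _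
        rel = u⊑w _ (trans (lin-axpy u c s (idMat k))
                    (trans (cong₂ _⊕_ uc (cong (s ∙_) (trans (lin-idMat u k) uₖ))) (⊕-self _)))
        wc : lin w c ≡ s ∷ 𝟎 n
        wc = trans (⊕≡𝟎⇒≡ _ _ (trans (sym (lin-axpy w c s (idMat k))) rel))
                   (trans (cong (s ∙_) (trans (lin-idMat w k) wₖ)) (sym (∙-e₀ s)))
        (heads , tails) = ∷-injective (trans (sym (lin-∷ w c)) wc)
    in tails , sym heads

linear-extension : (u w : Fin m → Pt n) → u ⊑ w → w ⊑ u →
  Σ (LinearAut n) λ F → ∀ k → to F (u k) ≡ w k

private
  extension-at-e₀ : ∀ k (u w : Fin m → Pt (suc n)) → u k ≡ e₀ n → w k ≡ e₀ n → u ⊑ w → w ⊑ u →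
    Σ (LinearAut (suc n)) λ G → ∀ j → to G (u j) ≡ w j
  extension-at-e₀ k u w uₖ wₖ u⊑w w⊑u =
    let (F , F-ok) = linear-extension (tail ∘ u) (tail ∘ w)
                       (λ c → proj₁ ∘ tails-⊑ k uₖ wₖ u⊑w c) (λ c → proj₁ ∘ tails-⊑ k wₖ uₖ w⊑u c)
        (ℓ , ℓ-ok) = functional-extension (tail ∘ u) (λ j → head (u j) xor head (w j)) λ c ū≡𝟎 →
                       trans (⊙-xor c (head ∘ u) (head ∘ w))
                             (trans (cong (_xor c ⊙ (head ∘ w)) (proj₂ (tails-⊑ k uₖ wₖ u⊑w c ū≡𝟎)))
                                    (xor-same (c ⊙ (head ∘ w))))
    in liftᴸ F ∘ᴸ transvection ℓ , λ j →
         trans (cong₂ _∷_ (trans (cong (head (u j) xor_) (ℓ-ok j)) (xor-cancelˡ (head (u j)) _)) (F-ok j))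
               (head∷tail (w j))

linear-extension {n = zero} u w _ _ = idᴸ , λ k → Pt₀-unique _ _
linear-extension {n = suc n} u w u⊑w w⊑u with any? (λ k → ¬? (u k ≟ᵥ 𝟎 (suc n)))
... | no ∄k = idᴸ , λ k →
  let uₖ≡𝟎 = decidable-stable (u k ≟ᵥ 𝟎 _) (∄k ∘ (k ,_))
  in trans uₖ≡𝟎 (sym (trans (sym (lin-idMat w k)) (u⊑w (idMat k) (trans (lin-idMat u k) uₖ≡𝟎))))
... | yes (k , uₖ≢𝟎) =
  let wₖ≢𝟎 = λ wₖ≡𝟎 →
        uₖ≢𝟎 (trans (sym (lin-idMat u k)) (w⊑u (idMat k) (trans (lin-idMat w k) wₖ≡𝟎)))
      (H₁ , H₁uₖ) = normalise (u k) uₖ≢𝟎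
      (H₂ , H₂wₖ) = normalise (w k) wₖ≢𝟎
      (G , G-ok) = extension-at-e₀ k (to H₁ ∘ u) (to H₂ ∘ w) H₁uₖ H₂wₖ
                                   (⊑-aut H₁ H₂ u⊑w) (⊑-aut H₂ H₁ w⊑u)
  in symᴸ H₂ ∘ᴸ (G ∘ᴸ H₁) , λ j → trans (cong (from H₂) (G-ok j)) (LinearAut.strictlyInverseʳ H₂ (w j))

-- c ↦ c + (Σ c) δ₀ turns linear relations of the uₖ ⊕ u₀ into affine relations of the uₖ.
private
  ⊑ᴬ⇒⊑-translate : {u w : Fin (suc m) → Pt n} → u ⊑ᴬ w → (λ k → u k ⊕ u zero) ⊑ (λ k → w k ⊕ w zero)
  ⊑ᴬ⇒⊑-translate {m} {u = u} {w} u⊑w c u′≡𝟎 =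
    let s = xorSum (suc m) c
        c* = λ k → c k xor (s ∧ idMat zero k)
        shifted : ∀ (v : Fin (suc m) → Pt _) → lin v c* ≡ lin (λ k → v k ⊕ v zero) c
        shifted v = trans (lin-axpy v c s (idMat zero))
                          (trans (cong (λ x → lin v c ⊕ s ∙ x) (lin-idMat v zero)) (sym (lin-translate v (v zero) c)))
        sum-c* : xorSum (suc m) c* ≡ false
        sum-c* = trans (xorSum-axpy (suc m) c s (idMat zero))
                       (trans (cong (λ b → s xor (s ∧ b)) sum-δ) (trans (cong (s xor_) (∧-identityʳ s)) (xor-same s)))
    in trans (sym (shifted w)) (proj₂ (u⊑w c* (sum-c* , trans (shifted u) u′≡𝟎)))
    where
    sum-δ : xorSum (suc m) (idMat zero) ≡ true
    sum-δ = cong not (xorSum-zero {m} λ _ → refl)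

affine-extension : (u w : Fin m → Pt n) → u ⊑ᴬ w → w ⊑ᴬ u →
  Σ (LinearAut n) λ F → Σ (Pt n) λ b → ∀ k → to F (u k) ⊕ b ≡ w k
affine-extension {zero}  u w _ _ = idᴸ , 𝟎 _ , λ ()
affine-extension {suc m} u w u⊑w w⊑u =
  let (F , F-ok) = linear-extension _ _ (⊑ᴬ⇒⊑-translate {u = u} {w} u⊑w) (⊑ᴬ⇒⊑-translate {u = w} {u} w⊑u)
  in F , to F (u zero) ⊕ w zero , λ k → begin
       to F (u k) ⊕ (to F (u zero) ⊕ w zero)   ≡⟨ ⊕-assoc _ _ _ ⟨
       (to F (u k) ⊕ to F (u zero)) ⊕ w zero   ≡⟨ cong (_⊕ w zero) (to-⊕ F _ _) ⟨
       to F (u k ⊕ u zero) ⊕ w zero            ≡⟨ cong (_⊕ w zero) (F-ok k) ⟩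
       (w k ⊕ w zero) ⊕ w zero                 ≡⟨ ⊕-cancelʳ (w zero) (w k) ⟩
       w k                                     ∎
  where open ≡-Reasoning

allPts-unique : ∀ n → Unique (allPts n)
allPts-unique zero    = [] ∷ []
allPts-unique (suc n) =
  Unique.++⁺ (Unique.map⁺ ∷-injectiveʳ (allPts-unique n)) (Unique.map⁺ ∷-injectiveʳ (allPts-unique n)) disjoint
  where
  disjoint : ∀ {z} → z ∈ map (true ∷_) (allPts n) × z ∈ map (false ∷_) (allPts n) → ⊥
  disjoint (z∈₁ , z∈₂) with ∈-map⁻ (true ∷_) z∈₁ | ∈-map⁻ (false ∷_) z∈₂
  ... | _ , _ , refl | _ , _ , ()

isOdd : ℕ → Bool
isOdd zero    = false
isOdd (suc k) = not (isOdd k)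

isOdd≡false⇔2∣ : ∀ k → isOdd k ≡ false ⇔ 2 ∣ k
isOdd≡false⇔2∣ k = mk⇔ (even⇒2∣ k) (λ { (divides q refl) → isOdd-double q })
  where
  even⇒2∣ : ∀ k → isOdd k ≡ false → 2 ∣ k
  even⇒2∣ zero          _  = divides 0 refl
  even⇒2∣ (suc (suc k)) eq with even⇒2∣ k (trans (sym (not-involutive _)) eq)
  ... | divides q refl = divides (suc q) refl
  isOdd-double : ∀ q → isOdd (q * 2) ≡ false
  isOdd-double zero    = refl
  isOdd-double (suc q) = trans (not-involutive _) (isOdd-double q)

module _ {A : Set} where

  isOdd-countL-∷ : ∀ a (L : List A) Z → isOdd (countL (a ∷ L) Z) ≡ Z a xor isOdd (countL L Z)
  isOdd-countL-∷ a L Z with Z a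
  ... | true  = refl
  ... | false = refl

  isOdd-countL-xor : ∀ (L : List A) X Y →
    isOdd (countL L (λ x → X x xor Y x)) ≡ isOdd (countL L X) xor isOdd (countL L Y)
  isOdd-countL-xor []      X Y = refl
  isOdd-countL-xor (a ∷ L) X Y = begin
    isOdd (countL (a ∷ L) (λ x → X x xor Y x))
      ≡⟨ isOdd-countL-∷ a L (λ x → X x xor Y x) ⟩
    (X a xor Y a) xor isOdd (countL L (λ x → X x xor Y x))
      ≡⟨ cong ((X a xor Y a) xor_) (isOdd-countL-xor L X Y) ⟩
    (X a xor Y a) xor (isOdd (countL L X) xor isOdd (countL L Y))
      ≡⟨ xor-interchange (X a) (Y a) _ _ ⟩
    (X a xor isOdd (countL L X)) xor (Y a xor isOdd (countL L Y))
      ≡⟨ cong₂ _xor_ (isOdd-countL-∷ a L X) (isOdd-countL-∷ a L Y) ⟨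
    isOdd (countL (a ∷ L) X) xor isOdd (countL (a ∷ L) Y) ∎
    where open ≡-Reasoning

  countL-cong : ∀ (L : List A) {X Y} → (∀ x → X x ≡ Y x) → countL L X ≡ countL L Y
  countL-cong []      X≗Y = refl
  countL-cong (a ∷ L) X≗Y rewrite X≗Y a = cong (λ k → if _ then suc k else k) (countL-cong L X≗Y)

  countL-zero : ∀ (L : List A) {Z} → All (λ x → Z x ≡ false) L → countL L Z ≡ 0
  countL-zero []      []           = refl
  countL-zero (a ∷ L) (Za≡f ∷ all) rewrite Za≡f = countL-zero L all

  countL-disjoint-xor : ∀ (L : List A) X Y → (∀ x → X x ∧ Y x ≡ false) →
    countL L (λ x → X x xor Y x) ≡ countL L X + countL L Y
  countL-disjoint-xor []      X Y _ = refl
  countL-disjoint-xor (a ∷ L) X Y disj with X a | Y a | disj a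
  ... | true  | false | _ = cong suc (countL-disjoint-xor L X Y disj)
  ... | false | true  | _ = trans (cong suc (countL-disjoint-xor L X Y disj)) (sym (+-suc _ _))
  ... | false | false | _ = countL-disjoint-xor L X Y disj

sumL-∷ : ∀ a (L : List (Pt n)) Z → sumL (a ∷ L) Z ≡ Z a ∙ a ⊕ sumL L Z
sumL-∷ a L Z with Z a
... | true  = refl
... | false = sym (⊕-identityˡ _)

sumL-xor : ∀ (L : List (Pt n)) X Y → sumL L (λ x → X x xor Y x) ≡ sumL L X ⊕ sumL L Y
sumL-xor []      X Y = sym (⊕-self _)
sumL-xor (a ∷ L) X Y = begin
  sumL (a ∷ L) (λ x → X x xor Y x)                   ≡⟨ sumL-∷ a L (λ x → X x xor Y x) ⟩
  (X a xor Y a) ∙ a ⊕ sumL L (λ x → X x xor Y x)     ≡⟨ cong₂ _⊕_ (∙-distrib-xor (X a) (Y a) a) (sumL-xor L X Y) ⟩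
  (X a ∙ a ⊕ Y a ∙ a) ⊕ (sumL L X ⊕ sumL L Y)         ≡⟨ ⊕-interchange _ _ _ _ ⟩
  (X a ∙ a ⊕ sumL L X) ⊕ (Y a ∙ a ⊕ sumL L Y)         ≡⟨ cong₂ _⊕_ (sumL-∷ a L X) (sumL-∷ a L Y) ⟨
  sumL (a ∷ L) X ⊕ sumL (a ∷ L) Y                    ∎
  where open ≡-Reasoning

sumL-cong : ∀ (L : List (Pt n)) {X Y} → (∀ x → X x ≡ Y x) → sumL L X ≡ sumL L Y
sumL-cong []      X≗Y = refl
sumL-cong (a ∷ L) X≗Y rewrite X≗Y a = cong (λ v → if _ then a ⊕ v else v) (sumL-cong L X≗Y)

sumL-zero : ∀ (L : List (Pt n)) {Z} → All (λ x → Z x ≡ false) L → sumL L Z ≡ 𝟎 n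
sumL-zero []      []           = refl
sumL-zero (a ∷ L) (Za≡f ∷ all) rewrite Za≡f = sumL-zero L all

singleton : Pt n → Subset n
singleton p y = does (p ≟ᵥ y)

private
  singleton-elsewhere : ∀ {p} {L : List (Pt n)} → All (p ≢_) L → All (λ x → singleton p x ≡ false) L
  singleton-elsewhere = All.map (dec-false (_ ≟ᵥ _))

  countL-singleton : ∀ {p} {L : List (Pt n)} → Unique L → p ∈ L → countL L (singleton p) ≡ 1
  countL-singleton {p = p} (p∉L ∷ _) (here refl) rewrite dec-true (p ≟ᵥ p) refl =
    cong suc (countL-zero _ (singleton-elsewhere p∉L))
  countL-singleton {p = p} {x ∷ L} (x∉L ∷ uniq) (there p∈L)
    rewrite dec-false (p ≟ᵥ x) (λ { refl → All.lookup x∉L p∈L refl }) = countL-singleton uniq p∈L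

  sumL-singleton : ∀ {p} {L : List (Pt n)} → Unique L → p ∈ L → sumL L (singleton p) ≡ p
  sumL-singleton {p = p} (p∉L ∷ _) (here refl) rewrite dec-true (p ≟ᵥ p) refl =
    trans (cong (p ⊕_) (sumL-zero _ (singleton-elsewhere p∉L))) (⊕-identityʳ p)
  sumL-singleton {p = p} {x ∷ L} (x∉L ∷ uniq) (there p∈L)
    rewrite dec-false (p ≟ᵥ x) (λ { refl → All.lookup x∉L p∈L refl }) = sumL-singleton uniq p∈L

card-singleton : ∀ (p : Pt n) → card (singleton p) ≡ 1
card-singleton {n} p = countL-singleton (allPts-unique n) (allPts-complete p)

setSum-singleton : ∀ (p : Pt n) → setSum (singleton p) ≡ p
setSum-singleton {n} p = sumL-singleton (allPts-unique n) (allPts-complete p)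

card-∅ : card {n} (λ _ → false) ≡ 0
card-∅ {n} = countL-zero (allPts n) (All.universal (λ _ → refl) _)

-- Even zero-sum subsets in coordinates

isOdd-card-comb : (Z : Fin r → Subset n) (c : Fin r → Bool) →
  isOdd (card (comb Z c)) ≡ c ⊙ (isOdd ∘ card ∘ Z)
isOdd-card-comb {zero} {n} Z c = cong isOdd (card-∅ {n})
isOdd-card-comb {suc r} {n} Z c =
  trans (isOdd-countL-xor (allPts n) (λ x → c zero ∧ Z zero x) (comb (Z ∘ suc) (c ∘ suc)))
        (cong₂ _xor_ (first (c zero)) (isOdd-card-comb (Z ∘ suc) (c ∘ suc)))
  where
  first : ∀ b → isOdd (card (λ x → b ∧ Z zero x)) ≡ b ∧ isOdd (card (Z zero))
  first true  = refl
  first false = cong isOdd (card-∅ {n})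

setSum-comb : (Z : Fin r → Subset n) (c : Fin r → Bool) → setSum (comb Z c) ≡ lin (setSum ∘ Z) c
setSum-comb {zero}  {n} Z c = sumL-zero (allPts n) (All.universal (λ _ → refl) _)
setSum-comb {suc r} {n} Z c =
  trans (sumL-xor (allPts n) (λ x → c zero ∧ Z zero x) (comb (Z ∘ suc) (c ∘ suc)))
        (cong₂ _⊕_ (first (c zero)) (setSum-comb (Z ∘ suc) (c ∘ suc)))
  where
  first : ∀ b → setSum (λ x → b ∧ Z zero x) ≡ b ∙ setSum (Z zero)
  first true  = refl
  first false = sumL-zero (allPts n) (All.universal (λ _ → refl) _)

combᶠ : (Fin r → Fin m → Bool) → (Fin r → Bool) → Fin m → Bool
combᶠ {r} κ d k = xorSum r (λ i → d i ∧ κ i k)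

comb-comb : (Z : Fin m → Subset n) (κ : Fin r → Fin m → Bool) (d : Fin r → Bool) →
  comb (λ i → comb Z (κ i)) d ≐ comb Z (combᶠ κ d)
comb-comb {m} {r = r} Z κ d x = xorSum-∧-assoc r m d κ (λ k → Z k x)

true≢false : true ≢ false
true≢false ()

⊆-false : {Z S : Subset n} → Z ⊆ S → ∀ {x} → S x ≡ false → Z x ≡ false
⊆-false {Z = Z} Z⊆S {x} Sx≡f with Z x in Zx
... | true  = ⊥-elim (true≢false (trans (sym (Z⊆S x Zx)) Sx≡f))
... | false = refl

false⇒⊆ : {Z S : Subset n} → (∀ {x} → S x ≡ false → Z x ≡ false) → Z ⊆ S
false⇒⊆ {S = S} out x Zx≡t with S x in Sx
... | true  = refl
... | false = trans (sym (out Sx)) Zx≡t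

InE-cong : {S X Y : Subset n} → X ≐ Y → InE S X → InE S Y
InE-cong {n} X≐Y (X⊆S , even , sum) =
  (λ x Yx → X⊆S x (trans (X≐Y x) Yx)) ,
  subst (2 ∣_) (countL-cong (allPts n) X≐Y) even ,
  trans (sym (sumL-cong (allPts n) X≐Y)) sum

InE-comb : {T : Subset n} (Y : Fin r → Subset n) → (∀ i → InE T (Y i)) → ∀ d → InE T (comb Y d)
InE-comb {n} {r} Y Y∈E d =
  false⇒⊆ (λ Tx≡f → xorSum-zero λ i → trans (cong (d i ∧_) (⊆-false (proj₁ (Y∈E i)) Tx≡f)) (∧-zeroʳ _)) ,
  Equivalence.to (isOdd≡false⇔2∣ _) (trans (isOdd-card-comb Y d) (xorSum-zero λ i →
    trans (cong (d i ∧_) (Equivalence.from (isOdd≡false⇔2∣ _) (proj₁ (proj₂ (Y∈E i))))) (∧-zeroʳ _))) ,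
  trans (setSum-comb Y d) (lin-𝟎ᶠ _ d (proj₂ ∘ proj₂ ∘ Y∈E))

-- img u c = { uₖ ∣ cₖ = true }, written as a combination of singletons so that comb-comb applies.
img : (Fin m → Pt n) → (Fin m → Bool) → Subset n
img u = comb (singleton ∘ u)

img-cong : (u : Fin m → Pt n) {c c′ : Fin m → Bool} → (∀ k → c k ≡ c′ k) → img u c ≐ img u c′
img-cong u c≗c′ x = xorSum-cong λ k → cong (_∧ singleton (u k) x) (c≗c′ k)

img-at : (u : Fin m → Pt n) → (∀ {k l} → u k ≡ u l → k ≡ l) → ∀ c j → img u c (u j) ≡ c j
img-at {m} u u-inj c j = trans
  (xorSum-cong λ k → trans (cong (c k ∧_) (does-⇔ (mk⇔ (sym ∘ u-inj) λ { refl → refl }) (u k ≟ᵥ u j) (j ≟ k)))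
                           (∧-comm (c k) _))
  (xorSum-idMat m c j)

img-outside : (u : Fin m → Pt n) (c : Fin m → Bool) {y : Pt n} → (∀ k → u k ≢ y) → img u c y ≡ false
img-outside u c u≢y = xorSum-zero λ k → trans (cong (c _ ∧_) (dec-false (u k ≟ᵥ _) (u≢y k))) (∧-zeroʳ _)

record Enumerates (S : Subset n) (u : Fin m → Pt n) : Set where
  field
    member    : ∀ k → S (u k) ≡ true
    cover     : ∀ y → S y ≡ true → ∃ λ k → u k ≡ y
    injective : ∀ {k l} → u k ≡ u l → k ≡ l

private
  outside : {S : Subset n} {u : Fin m → Pt n} → (∀ k → S (u k) ≡ true) → ∀ {y} → S y ≡ false → ∀ k → u k ≢ y
  outside u∈S Sy≡f k refl = true≢false (trans (sym (u∈S k)) Sy≡f)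

img⊆ : {S : Subset n} (u : Fin m → Pt n) → (∀ k → S (u k) ≡ true) → ∀ c → img u c ⊆ S
img⊆ u u∈S c = false⇒⊆ λ Sy≡f → img-outside u c (outside u∈S Sy≡f)

⊆⇒img : {S Z : Subset n} {u : Fin m → Pt n} → Enumerates S u → Z ⊆ S → Z ≐ img u (Z ∘ u)
⊆⇒img {S = S} {Z} {u} en Z⊆S y with S y in Sy
... | true  = let (k , uₖ≡y) = Enumerates.cover en y Sy
              in subst (λ x → Z x ≡ img u (Z ∘ u) x) uₖ≡y (sym (img-at u (Enumerates.injective en) (Z ∘ u) k))
... | false = trans (⊆-false Z⊆S Sy) (sym (img-outside u _ (outside (Enumerates.member en) Sy)))

InE-img⇔AffRel : {S : Subset n} (u : Fin m → Pt n) → (∀ k → S (u k) ≡ true) → ∀ c → InE S (img u c) ⇔ AffRel u c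
InE-img⇔AffRel {m = m} u u∈S c = mk⇔
  (λ (_ , even , sum) → trans (sym (parity c)) (Equivalence.from (isOdd≡false⇔2∣ _) even) ,
                        trans (sym (setSum-img c)) sum)
  (λ (odd , rel) → img⊆ u u∈S c ,
                   Equivalence.to (isOdd≡false⇔2∣ _) (trans (parity c) odd) ,
                   trans (setSum-img c) rel)
  where
  parity : ∀ c → isOdd (card (img u c)) ≡ xorSum m c
  parity c = trans (isOdd-card-comb (singleton ∘ u) c)
                   (xorSum-cong λ k → trans (cong (λ n → c k ∧ isOdd n) (card-singleton (u k))) (∧-identityʳ (c k)))
  setSum-img : ∀ c → setSum (img u c) ≡ lin u c
  setSum-img c = trans (setSum-comb (singleton ∘ u) c) (lin-congᶠ c (setSum-singleton ∘ u))

-- Bases of relation spaces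

record BasisOf {m} (P : (Fin m → Bool) → Set) : Set where
  field
    dim         : ℕ
    basis       : Fin dim → Fin m → Bool
    basis∈      : ∀ i → P (basis i)
    independent : ∀ d → (∀ k → combᶠ basis d k ≡ false) → ∀ i → d i ≡ false
    spanning    : ∀ c → P c → ∃ λ d → ∀ k → combᶠ basis d k ≡ c k

BasisOf-resp : {P Q : (Fin m → Bool) → Set} → (∀ c → P c ⇔ Q c) → BasisOf P → BasisOf Q
BasisOf-resp P⇔Q B = record
  { dim = dim ; basis = basis ; independent = independent
  ; basis∈   = λ i → Equivalence.to (P⇔Q (basis i)) (basis∈ i)
  ; spanning = λ c → spanning c ∘ Equivalence.from (P⇔Q c) }
  where open BasisOf B

private
  relation-tail : (v : Fin (suc m) → Pt n) (c : Fin (suc m) → Bool) →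
    lin v c ≡ 𝟎 n → lin (v ∘ suc) (c ∘ suc) ≡ c zero ∙ v zero
  relation-tail v c rel = sym (⊕≡𝟎⇒≡ _ _ rel)

  xorSum-∧-false : (d : Fin r → Bool) → xorSum r (λ i → d i ∧ false) ≡ false
  xorSum-∧-false d = xorSum-zero (∧-zeroʳ ∘ d)

  relationBasis-independent : (v : Fin (suc m) → Pt n) → BasisOf (λ c → lin (v ∘ suc) c ≡ 𝟎 n) →
    ¬ (∃ λ c → lin (v ∘ suc) c ≡ v zero) → BasisOf (λ c → lin v c ≡ 𝟎 n)
  relationBasis-independent {n = n} v B v₀∉span = record
    { dim = dim ; basis = λ i → false ◂ basis i
    ; basis∈ = λ i → trans (⊕-identityˡ _) (basis∈ i)
    ; independent = λ d d↦0 → independent d (d↦0 ∘ suc)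
    ; spanning = span }
    where
    open BasisOf B
    span : ∀ c → lin v c ≡ 𝟎 n → ∃ λ d → ∀ k → combᶠ (λ i → false ◂ basis i) d k ≡ c k
    span c rel with c zero in c₀≡ | relation-tail v c rel
    ... | true  | v₀∈span = ⊥-elim (v₀∉span (_ , v₀∈span))
    ... | false | rel′ = let (d , d↦c) = spanning _ rel′
                         in d , λ { zero → trans (xorSum-∧-false d) (sym c₀≡) ; (suc k) → d↦c k }

  -- v₀ = Σₖ c₀ₖ vₖ₊₁ adds the relation (1, c₀) to those of the tail.
  relationBasis-dependent : (v : Fin (suc m) → Pt n) → BasisOf (λ c → lin (v ∘ suc) c ≡ 𝟎 n) →
    (∃ λ c → lin (v ∘ suc) c ≡ v zero) → BasisOf (λ c → lin v c ≡ 𝟎 n)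
  relationBasis-dependent {m} {n} v B (c₀ , c₀↦v₀) = record
    { dim = suc dim ; basis = κ
    ; basis∈ = λ { zero → trans (cong (v zero ⊕_) c₀↦v₀) (⊕-self _)
                 ; (suc i) → trans (⊕-identityˡ _) (basis∈ i) }
    ; independent = indep
    ; spanning = span }
    where
    open BasisOf B
    κ : Fin (suc dim) → Fin (suc m) → Bool
    κ = (true ◂ c₀) ◂ λ i → false ◂ basis i
    κ-zero : ∀ d → combᶠ κ d zero ≡ d zero
    κ-zero d = trans (cong₂ _xor_ (∧-identityʳ (d zero)) (xorSum-∧-false (d ∘ suc))) (xor-identityʳ _)
    indep : ∀ d → (∀ k → combᶠ κ d k ≡ false) → ∀ i → d i ≡ false
    indep d d↦0 = λ { zero → d₀ ; (suc i) → independent (d ∘ suc) rest i }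
      where
      d₀ = trans (sym (κ-zero d)) (d↦0 zero)
      rest : ∀ k → combᶠ basis (d ∘ suc) k ≡ false
      rest k = trans (cong (λ b → (b ∧ c₀ k) xor combᶠ basis (d ∘ suc) k) (sym d₀)) (d↦0 (suc k))
    span : ∀ c → lin v c ≡ 𝟎 n → ∃ λ d → ∀ k → combᶠ κ d k ≡ c k
    span c rel with c zero in c₀≡ | relation-tail v c rel
    ... | true | c′↦v₀ =
      let (d , d↦c) = spanning (λ k → c (suc k) xor c₀ k)
                        (trans (lin-xor (v ∘ suc) (c ∘ suc) c₀) (trans (cong₂ _⊕_ c′↦v₀ c₀↦v₀) (⊕-self _)))
      in true ◂ d , λ { zero → trans (κ-zero (true ◂ d)) (sym c₀≡)
                      ; (suc k) → trans (cong (c₀ k xor_) (trans (d↦c k) (xor-comm _ (c₀ k))))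
                                        (xor-cancelˡ (c₀ k) (c (suc k))) }
    ... | false | rel′ =
      let (d , d↦c) = spanning _ rel′
      in false ◂ d , λ { zero → trans (κ-zero (false ◂ d)) (sym c₀≡) ; (suc k) → d↦c k }

relationBasis : (v : Fin m → Pt n) → BasisOf (λ c → lin v c ≡ 𝟎 n)
relationBasis {zero} v = record
  { dim = 0 ; basis = λ () ; basis∈ = λ () ; independent = λ _ _ () ; spanning = λ _ _ → (λ ()) , λ () }
relationBasis {suc m} v with span? (v ∘ suc) (v zero)
... | yes v₀∈span = relationBasis-dependent v (relationBasis (v ∘ suc)) v₀∈span
... | no  v₀∉span = relationBasis-independent v (relationBasis (v ∘ suc)) v₀∉span

affRelBasis : (u : Fin m → Pt n) → BasisOf (AffRel u)
affRelBasis {m} u = BasisOf-resp (λ c → mk⇔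
    (λ rel → ∷-injective (trans (sym (lin-affine c)) rel))
    (λ (sum , rel) → trans (lin-affine c) (cong₂ _∷_ sum rel)))
  (relationBasis (λ k → true ∷ u k))
  where
  lin-affine : ∀ c → lin (λ k → true ∷ u k) c ≡ xorSum m c ∷ lin u c
  lin-affine c = trans (lin-∷ _ c) (cong (_∷ lin u c) (xorSum-cong (∧-identityʳ ∘ c)))

isBasisE-img : {S : Subset n} {u : Fin m → Pt n} → Enumerates S u → (B : BasisOf (AffRel u)) →
  IsBasisE S (λ i → img u (BasisOf.basis B i))
isBasisE-img {S = S} {u} en B =
  (λ i → Equivalence.from (InE-img⇔AffRel u member (basis i)) (basis∈ i)) ,
  (λ d d↦∅ → independent d λ k → begin
     combᶠ basis d k                                   ≡⟨ img-at u injective _ k ⟨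
     img u (combᶠ basis d) (u k)                       ≡⟨ comb-comb (singleton ∘ u) basis d (u k) ⟨
     comb (λ i → img u (basis i)) d (u k)              ≡⟨ d↦∅ (u k) ⟩
     false                                             ∎) ,
  λ Y Y∈E →
    let Y≐ = ⊆⇒img en (proj₁ Y∈E)
        (d , d↦Y) = spanning (Y ∘ u) (Equivalence.to (InE-img⇔AffRel u member (Y ∘ u)) (InE-cong Y≐ Y∈E))
    in d , λ x → trans (comb-comb (singleton ∘ u) basis d x) (trans (img-cong u d↦Y x) (sym (Y≐ x)))
  where
  open BasisOf B
  open Enumerates en
  open ≡-Reasoning

card-img-invariant : {u w : Fin m → Pt n} → (∀ {k l} → u k ≡ u l → k ≡ l) → (∀ {k l} → w k ≡ w l → k ≡ l) →
  ∀ c → card (img u c) ≡ card (img w c)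
card-img-invariant {zero}  _ _ c = refl
card-img-invariant {suc m} {n} {u} {w} u-inj w-inj c = begin
  card (img u c)                                                      ≡⟨ split u u-inj ⟩
  card (λ x → c zero ∧ singleton (u zero) x) + card (img (u ∘ suc) (c ∘ suc))
    ≡⟨ cong₂ _+_ (first (c zero))
                 (card-img-invariant (Fin-suc-injective ∘ u-inj) (Fin-suc-injective ∘ w-inj) (c ∘ suc)) ⟩
  card (λ x → c zero ∧ singleton (w zero) x) + card (img (w ∘ suc) (c ∘ suc)) ≡⟨ split w w-inj ⟨
  card (img w c)                                                      ∎
  where
  open ≡-Reasoning
  first : ∀ b → card (λ x → b ∧ singleton (u zero) x) ≡ card (λ x → b ∧ singleton (w zero) x)
  first true  = trans (card-singleton (u zero)) (sym (card-singleton (w zero)))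
  first false = refl
  split : (v : Fin (suc m) → Pt n) → (∀ {k l} → v k ≡ v l → k ≡ l) →
    card (img v c) ≡ card (λ x → c zero ∧ singleton (v zero) x) + card (img (v ∘ suc) (c ∘ suc))
  split v v-inj = countL-disjoint-xor (allPts n) _ _ λ x → disjoint x (v zero ≟ᵥ x)
    where
    disjoint : ∀ x → Dec (v zero ≡ x) → (c zero ∧ singleton (v zero) x) ∧ img (v ∘ suc) (c ∘ suc) x ≡ false
    disjoint x (yes refl) =
      trans (cong ((c zero ∧ _) ∧_) (img-outside (v ∘ suc) (c ∘ suc) λ k e → case v-inj e of λ ())) (∧-zeroʳ _)
    disjoint x (no v₀≢x) =
      trans (cong (λ b → (c zero ∧ b) ∧ img (v ∘ suc) (c ∘ suc) x) (dec-false (v zero ≟ᵥ x) v₀≢x))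
            (cong (_∧ img (v ∘ suc) (c ∘ suc) x) (∧-zeroʳ (c zero)))

andAll-cong : {f g : Fin r → Bool} → (∀ i → f i ≡ g i) → andAll r f ≡ andAll r g
andAll-cong {zero}  f≗g = refl
andAll-cong {suc r} f≗g = cong₂ _∧_ (f≗g zero) (andAll-cong (f≗g ∘ suc))

venn⊆ : (S : Subset n) (X : Fin r → Subset n) (a : Fin r → Bool) → venn S X a ⊆ S
venn⊆ S X a x = ∧-conicalˡ (S x) _

venn-img : {S : Subset n} {u : Fin m → Pt n} → Enumerates S u → (κ : Fin r → Fin m → Bool) (a : Fin r → Bool) →
  venn S (λ i → img u (κ i)) a ≐ img u (λ k → andAll r (λ i → does (κ i k Bool.≟ a i)))
venn-img {r = r} {S} {u} en κ a x = trans (⊆⇒img en (venn⊆ S (λ i → img u (κ i)) a) x) (img-cong u at x)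
  where
  open Enumerates en
  at : ∀ k → venn S (λ i → img u (κ i)) a (u k) ≡ andAll r (λ i → does (κ i k Bool.≟ a i))
  at k = trans (cong (_∧ _) (member k))
               (andAll-cong λ i → cong (λ b → does (b Bool.≟ a i)) (img-at u injective (κ i) k))

record AffineMatching (S T : Subset n) : Set where
  field
    size   : ℕ
    u w    : Fin size → Pt n
    u-enum : Enumerates S u
    w-enum : Enumerates T w
    u⊑w    : u ⊑ᴬ w
    w⊑u    : w ⊑ᴬ u

matching⇒vennBij : {S T : Subset n} → AffineMatching S T → CardPresVennBij S T
matching⇒vennBij {S = S} {T} M =
  dim , (λ i → img u (basis i)) , (λ i → img w (basis i)) , idMat ,
  isBasisE-img u-enum B ,
  isBasisE-img w-enum (BasisOf-resp (λ c → mk⇔ (u⊑w c) (w⊑u c)) B) ,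
  (idMat , idMat-idem , idMat-idem) ,
  λ a → begin
    card (venn T Y (mulVec idMat a))  ≡⟨ countL-cong (allPts _) (λ x → cong (T x ∧_) (andAll-cong λ i →
                                           cong (λ b → does (Y i x Bool.≟ b)) (xorSum-idMat _ a i))) ⟩
    card (venn T Y a)                 ≡⟨ countL-cong (allPts _) (venn-img w-enum basis a) ⟩
    card (img w (inRegion a))         ≡⟨ card-img-invariant (injective w-enum) (injective u-enum) _ ⟩
    card (img u (inRegion a))         ≡⟨ countL-cong (allPts _) (venn-img u-enum basis a) ⟨
    card (venn S X a)                 ∎
  where
  open AffineMatching M
  open Enumerates using (injective)
  B = affRelBasis u
  open BasisOf B
  X Y : Fin dim → Subset _
  X i = img u (basis i)
  Y i = img w (basis i)
  inRegion : (Fin dim → Bool) → Fin size → Bool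
  inRegion a k = andAll dim (λ i → does (basis i k Bool.≟ a i))
  idMat-idem : ∀ i j → (idMat · idMat) i j ≡ idMat i j
  idMat-idem i j = xorSum-idMat dim (λ k → idMat k j) i
  open ≡-Reasoning

mulPt : Mat n → Pt n → Pt n
mulPt {n} A x = tabulate (λ i → xorSum n (λ j → A i j ∧ lookup x j))

lookup-mulPt : (A : Mat n) (x : Pt n) (i : Fin n) → lookup (mulPt A x) i ≡ xorSum n (λ j → A i j ∧ lookup x j)
lookup-mulPt A x i = lookup∘tabulate _ i

mulPt-⊕ : (A : Mat n) → Additive (mulPt A)
mulPt-⊕ {n} A x y = lookup-ext λ i → begin
  lookup (mulPt A (x ⊕ y)) i
    ≡⟨ lookup-mulPt A (x ⊕ y) i ⟩
  xorSum n (λ j → A i j ∧ lookup (x ⊕ y) j)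
    ≡⟨ xorSum-cong (λ j → trans (cong (A i j ∧_) (lookup-⊕ x y j)) (∧-distribˡ-xor (A i j) _ _)) ⟩
  xorSum n (λ j → (A i j ∧ lookup x j) xor (A i j ∧ lookup y j))
    ≡⟨ xorSum-distrib-xor n _ _ ⟩
  xorSum n (λ j → A i j ∧ lookup x j) xor xorSum n (λ j → A i j ∧ lookup y j)
    ≡⟨ cong₂ _xor_ (lookup-mulPt A x i) (lookup-mulPt A y i) ⟨
  lookup (mulPt A x) i xor lookup (mulPt A y) i
    ≡⟨ lookup-⊕ (mulPt A x) (mulPt A y) i ⟨
  lookup (mulPt A x ⊕ mulPt A y) i ∎
  where open ≡-Reasoning

mulPt-· : (B A : Mat n) (x : Pt n) → mulPt B (mulPt A x) ≡ mulPt (B · A) x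
mulPt-· {n} B A x = lookup-ext λ i →
  trans (lookup-mulPt B (mulPt A x) i)
  (trans (xorSum-cong λ j → cong (B i j ∧_) (lookup-mulPt A x j))
  (trans (xorSum-∧-assoc n n (B i) A (lookup x))
  (sym (lookup-mulPt (B · A) x i))))

mulPt-idMat : (C : Mat n) → (∀ i j → C i j ≡ idMat i j) → ∀ x → mulPt C x ≡ x
mulPt-idMat {n} C C≗I x = lookup-ext λ i →
  trans (lookup-mulPt C x i) (trans (xorSum-cong λ j → cong (_∧ lookup x j) (C≗I i j)) (xorSum-idMat n (lookup x) i))

invertible⇒aut : (A : Mat n) → Invertible A → LinearAut n
invertible⇒aut A (B , AB≗I , BA≗I) = record
  { bijection = mk↔ₛ′ (mulPt A) (mulPt B) (λ y → trans (mulPt-· A B y) (mulPt-idMat _ AB≗I y))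
                                          (λ x → trans (mulPt-· B A x) (mulPt-idMat _ BA≗I x))
  ; to-⊕ = mulPt-⊕ A }

unit : Fin n → Pt n
unit j = tabulate (λ i → idMat i j)

matrixOf : (Pt n → Pt n) → Mat n
matrixOf f i j = lookup (f (unit j)) i

mulPt-matrixOf : {f : Pt n → Pt n} → Additive f → ∀ x → mulPt (matrixOf f) x ≡ f x
mulPt-matrixOf {n} {f} f-⊕ x = lookup-ext λ i → begin
  lookup (mulPt (matrixOf f) x) i                       ≡⟨ lookup-mulPt (matrixOf f) x i ⟩
  xorSum n (λ j → lookup (f (unit j)) i ∧ lookup x j)   ≡⟨ xorSum-cong (λ j → ∧-comm _ (lookup x j)) ⟩
  xorSum n (λ j → lookup x j ∧ lookup (f (unit j)) i)   ≡⟨ lookup-lin (f ∘ unit) (lookup x) i ⟨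
  lookup (lin (f ∘ unit) (lookup x)) i                  ≡⟨ cong (λ v → lookup v i) (additive-lin f-⊕ unit (lookup x)) ⟨
  lookup (f (lin unit (lookup x))) i                    ≡⟨ cong (λ v → lookup (f v) i) (lin-unit x) ⟩
  lookup (f x) i                                        ∎
  where
  open ≡-Reasoning
  lin-unit : ∀ x → lin unit (lookup x) ≡ x
  lin-unit x = lookup-ext λ i →
    trans (lookup-lin unit (lookup x) i)
          (trans (xorSum-cong λ k → trans (cong (lookup x k ∧_) (lookup∘tabulate _ i)) (∧-comm (lookup x k) _))
                 (xorSum-idMat n (lookup x) i))

aut⇒invertible : (F : LinearAut n) → Invertible (matrixOf (to F))
aut⇒invertible {n} F = matrixOf (from F) , inverse (to-⊕ F) (LinearAut.strictlyInverseˡ F)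
                                          , inverse (from-⊕ F) (LinearAut.strictlyInverseʳ F)
  where
  inverse : ∀ {f g : Pt n → Pt n} → Additive f → (∀ y → f (g y) ≡ y) →
            ∀ i j → (matrixOf f · matrixOf g) i j ≡ idMat i j
  inverse {f} {g} f-⊕ f∘g i j =
    trans (sym (lookup-mulPt (matrixOf f) (g (unit j)) i))
          (trans (cong (λ v → lookup v i) (trans (mulPt-matrixOf f-⊕ (g (unit j))) (f∘g (unit j))))
                 (lookup∘tabulate _ i))

AffineImage : (S T : Subset n) → Set
AffineImage {n} S T = Σ (LinearAut n) λ F → Σ (Pt n) λ b → ImageIs (λ x → to F x ⊕ b) S T

affinelyEquivalent⇔affineImage : {S T : Subset n} → AffinelyEquivalent S T ⇔ AffineImage S T
affinelyEquivalent⇔affineImage = mk⇔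
  (λ (A , b , A-inv , image) → invertible⇒aut A A-inv , b , image)
  (λ (F , b , image) → matrixOf (to F) , b , aut⇒invertible F , λ y → mk⇔
     (λ Ty → let (x , Sx , fx≡y) = Equivalence.to (image y) Ty
             in x , Sx , trans (cong (_⊕ b) (mulPt-matrixOf (to-⊕ F) x)) fx≡y)
     (λ (x , Sx , fx≡y) → Equivalence.from (image y)
                            (x , Sx , trans (cong (_⊕ b) (sym (mulPt-matrixOf (to-⊕ F) x))) fx≡y)))

-- Affine equivalence and matchings

module _ {A : Set} where

  lookup-injective : (zs : List A) (h : A → Pt n) → Unique (map h zs) →
    ∀ {k l} → h (lookupL zs k) ≡ h (lookupL zs l) → k ≡ l
  lookup-injective (z ∷ zs) h (_ ∷ _)  {zero}  {zero}  _  = refl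
  lookup-injective (z ∷ zs) h (z∉ ∷ _) {zero}  {suc l} eq = ⊥-elim (All.lookup z∉ (∈-map⁺ h (∈-lookup l)) eq)
  lookup-injective (z ∷ zs) h (z∉ ∷ _) {suc k} {zero}  eq = ⊥-elim (All.lookup z∉ (∈-map⁺ h (∈-lookup k)) (sym eq))
  lookup-injective (z ∷ zs) h (_ ∷ uniq) {suc k} {suc l} eq = cong suc (lookup-injective zs h uniq eq)

  listEnumerates : {S : Subset n} (zs : List A) (h : A → Pt n) → Unique (map h zs) →
    (∀ y → y ∈ map h zs ⇔ S y ≡ true) → Enumerates S (h ∘ lookupL zs)
  listEnumerates zs h uniq mem = record
    { member    = λ k → Equivalence.to (mem _) (∈-map⁺ h (∈-lookup k))
    ; cover     = λ y Sy → let (z , z∈zs , y≡hz) = ∈-map⁻ h (Equivalence.from (mem y) Sy)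
                           in Any.index z∈zs , sym (trans y≡hz (cong h (lookup-index z∈zs)))
    ; injective = lookup-injective zs h uniq }

elements : Subset n → List (Pt n)
elements {n} S = filter (λ x → S x Bool.≟ true) (allPts n)

elements-unique : (S : Subset n) → Unique (elements S)
elements-unique {n} S = Unique.filter⁺ _ (allPts-unique n)

∈-elements : (S : Subset n) → ∀ y → y ∈ elements S ⇔ S y ≡ true
∈-elements {n} S y = mk⇔ (proj₂ ∘ ∈-filter⁻ S? {xs = allPts n}) (∈-filter⁺ S? (allPts-complete y))
  where S? = λ x → S x Bool.≟ true

enumerate : (S : Subset n) → Σ ℕ λ m → Σ (Fin m → Pt n) (Enumerates S)
enumerate S = _ , _ , listEnumerates (elements S) id
  (subst Unique (sym (map-id _)) (elements-unique S))
  (λ y → subst (λ L → y ∈ L ⇔ _) (sym (map-id _)) (∈-elements S y))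

affineImage⇒matching : {S T : Subset n} → AffineImage S T → AffineMatching S T
affineImage⇒matching {n} {S} {T} (F , b , image) with enumerate S
... | size , u , u-enum = record
  { size = size ; u = u ; w = w ; u-enum = u-enum
  ; w-enum = record
    { member    = λ k → Equivalence.from (image (w k)) (u k , member k , refl)
    ; cover     = λ y Ty → let (x , Sx , fx≡y) = Equivalence.to (image y) Ty
                               (k , uₖ≡x) = cover x Sx
                           in k , trans (cong (λ z → to F z ⊕ b) uₖ≡x) fx≡y
    ; injective = λ eq → injective (LinearAut.to-injective F
                    (trans (sym (⊕-cancelʳ b _)) (trans (cong (_⊕ b) eq) (⊕-cancelʳ b _)))) }
  ; u⊑w = λ c (sum , rel) → sum , trans (lin-w c sum) (trans (cong (to F) rel) (additive-𝟎 (to-⊕ F)))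
  ; w⊑u = λ c (sum , rel) → sum , LinearAut.to≡𝟎 F (trans (sym (lin-w c sum)) rel) }
  where
  open Enumerates u-enum
  w : Fin size → Pt n
  w k = to F (u k) ⊕ b
  lin-w : ∀ c → xorSum size c ≡ false → lin w c ≡ to F (lin u c)
  lin-w c sum = begin
    lin w c                                  ≡⟨ lin-translate (to F ∘ u) b c ⟩
    lin (to F ∘ u) c ⊕ xorSum size c ∙ b     ≡⟨ cong (λ s → lin (to F ∘ u) c ⊕ s ∙ b) sum ⟩
    lin (to F ∘ u) c ⊕ 𝟎 n                   ≡⟨ ⊕-identityʳ _ ⟩
    lin (to F ∘ u) c                         ≡⟨ additive-lin (to-⊕ F) u c ⟨
    to F (lin u c)                           ∎
    where open ≡-Reasoning

matching⇒affineImage : {S T : Subset n} → AffineMatching S T → AffineImage S T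
matching⇒affineImage {T = T} M =
  let (F , b , F-ok) = affine-extension u w u⊑w w⊑u
  in F , b , λ y → mk⇔
       (λ Ty → let (k , wₖ≡y) = Enumerates.cover w-enum y Ty
               in u k , Enumerates.member u-enum k , trans (F-ok k) wₖ≡y)
       (λ (x , Sx , fx≡y) → let (k , uₖ≡x) = Enumerates.cover u-enum x Sx
                            in subst (λ z → T z ≡ true)
                                     (trans (sym (F-ok k)) (trans (cong (λ z → to F z ⊕ b) uₖ≡x) fx≡y))
                                     (Enumerates.member w-enum k))
  where open AffineMatching M

-- From Venn bijections to matchings

module _ {A : Set} where

  countL-↭ : {xs ys : List A} (P : A → Bool) → xs ↭ ys → countL xs P ≡ countL ys P
  countL-↭ P ↭.refl                 = refl
  countL-↭ P (↭.prep x p)           = cong (λ k → if P x then suc k else k) (countL-↭ P p)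
  countL-↭ P (↭.swap x y p) with P x | P y | countL-↭ P p
  ... | true  | true  | eq = cong (λ k → suc (suc k)) eq
  ... | true  | false | eq = cong suc eq
  ... | false | true  | eq = cong suc eq
  ... | false | false | eq = eq
  countL-↭ P (↭.trans p q)          = trans (countL-↭ P p) (countL-↭ P q)

  countL≡suc⇒∈ : ∀ (xs : List A) P {k} → countL xs P ≡ suc k → ∃ λ x → x ∈ xs × P x ≡ true
  countL≡suc⇒∈ (x ∷ xs) P eq with P x in Px
  ... | true  = x , here refl , Px
  ... | false = let (y , y∈xs , Py) = countL≡suc⇒∈ xs P eq in y , there y∈xs , Py

  countL-∷-true : ∀ {x} (xs : List A) {P} → P x ≡ true → countL (x ∷ xs) P ≡ suc (countL xs P)
  countL-∷-true xs Px rewrite Px = refl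

countL-∷-injective : ∀ {A B : Set} {x : A} {y : B} {xs ys} (P : A → Bool) (Q : B → Bool) → P x ≡ Q y →
  countL (x ∷ xs) P ≡ countL (y ∷ ys) Q → countL xs P ≡ countL ys Q
countL-∷-injective {x = x} {y} P Q Px≡Qy eq with P x | Q y
... | true  | true  = suc-injective eq
... | false | false = eq

does-true : ∀ {P : Set} (P? : Dec P) → does P? ≡ true → P
does-true (yes p) _ = p

module _ {A B K : Set} (_≟ₖ_ : DecidableEquality K) (f : A → K) (g : B → K) where

  pairing : (xs : List A) (ys : List B) →
    (∀ κ → countL xs (λ x → does (f x ≟ₖ κ)) ≡ countL ys (λ y → does (g y ≟ₖ κ))) →
    ∃ λ (zs : List (A × B)) → map proj₁ zs ≡ xs × map proj₂ zs ↭ ys × All (λ (x , y) → f x ≡ g y) zs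
  pairing [] []       _      = [] , refl , ↭.refl , []
  pairing [] (y ∷ ys) counts with g y ≟ₖ g y | counts (g y)
  ... | yes _     | ()
  ... | no gy≢gy  | _ = ⊥-elim (gy≢gy refl)
  pairing (x ∷ xs) ys counts =
    let (y , y∈ys , gy≟fx) = countL≡suc⇒∈ ys _
                               (trans (sym (counts (f x))) (countL-∷-true xs (dec-true (f x ≟ₖ f x) refl)))
        gy≡fx = does-true (g y ≟ₖ f x) gy≟fx
        (ys₁ , ys₂ , ys≡) = ∈-∃++ y∈ys
        ys↭ : ys ↭ y ∷ ys₁ ++ ys₂
        ys↭ = subst (_↭ y ∷ ys₁ ++ ys₂) (sym ys≡) (shift y ys₁ ys₂)
        counts′ : ∀ κ → countL xs (λ x → does (f x ≟ₖ κ)) ≡ countL (ys₁ ++ ys₂) (λ y → does (g y ≟ₖ κ))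
        counts′ κ = countL-∷-injective {xs = xs} {ys₁ ++ ys₂} (λ x → does (f x ≟ₖ κ)) (λ y → does (g y ≟ₖ κ))
                      (cong (λ k → does (k ≟ₖ κ)) (sym gy≡fx))
                      (trans (counts κ) (countL-↭ (λ y → does (g y ≟ₖ κ)) ys↭))
        (zs , zs₁ , zs₂↭ , keys) = pairing xs (ys₁ ++ ys₂) counts′
    in (x , y) ∷ zs , cong (x ∷_) zs₁ , ↭.trans (↭.prep y zs₂↭) (↭-sym ys↭) , sym gy≡fx ∷ keys

fibre-matching : {K : Set} (_≟ₖ_ : DecidableEquality K) {S T : Subset n} (σ τ : Pt n → K) →
  (∀ κ → countL (elements S) (λ s → does (σ s ≟ₖ κ)) ≡ countL (elements T) (λ t → does (τ t ≟ₖ κ))) →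
  Σ ℕ λ m → Σ (Fin m → Pt n) λ u → Σ (Fin m → Pt n) λ w →
    Enumerates S u × Enumerates T w × (∀ k → σ (u k) ≡ τ (w k))
fibre-matching {n} _≟ₖ_ {S} {T} σ τ counts =
  let (zs , zs₁≡ , zs₂↭ , keys) = pairing _≟ₖ_ σ τ (elements S) (elements T) counts
  in _ , proj₁ ∘ lookupL zs , proj₂ ∘ lookupL zs ,
     listEnumerates zs proj₁ (subst Unique (sym zs₁≡) (elements-unique S))
       (λ y → subst (λ L → y ∈ L ⇔ _) (sym zs₁≡) (∈-elements S y)) ,
     listEnumerates zs proj₂ (↭ₛ.Unique-resp-↭ (setoid (Pt n)) (↭⇒↭ₛ (↭-sym zs₂↭)) (elements-unique T))
       (λ y → ∈-elements T y ⇔-∘ mk⇔ (∈-resp-↭ zs₂↭) (∈-resp-↭ (↭-sym zs₂↭))) ,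
     λ k → All.lookup keys (∈-lookup k)

countL-elements : (S : Subset n) (Q : Subset n) → countL (elements S) Q ≡ card (λ x → S x ∧ Q x)
countL-elements {n} S Q = go (allPts n)
  where
  go : ∀ L → countL (filter (λ x → S x Bool.≟ true) L) Q ≡ countL L (λ x → S x ∧ Q x)
  go []      = refl
  go (x ∷ L) with S x
  ... | true  = cong (λ k → if Q x then suc k else k) (go L)
  ... | false = go L

andAll-≟ : (f g : Fin r → Bool) → andAll r (λ i → does (f i Bool.≟ g i)) ≡ does (tabulate f ≟ᵥ tabulate g)
andAll-≟ {zero}  f g = refl
andAll-≟ {suc r} f g = cong (does (f zero Bool.≟ g zero) ∧_) (andAll-≟ (f ∘ suc) (g ∘ suc))

tabulate-≡⇔ : {f g : Fin r → Bool} → tabulate f ≡ tabulate g ⇔ (∀ i → f i ≡ g i)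
tabulate-≡⇔ {f = f} {g} = mk⇔
  (λ eq i → trans (sym (lookup∘tabulate f i)) (trans (cong (λ v → lookup v i) eq) (lookup∘tabulate g i)))
  tabulate-cong

mulVec-cong : (A : Mat r) {a a′ : Fin r → Bool} → (∀ j → a j ≡ a′ j) → ∀ i → mulVec A a i ≡ mulVec A a′ i
mulVec-cong A a≗a′ i = xorSum-cong λ j → cong (A i j ∧_) (a≗a′ j)

mulVec-inverse : {N M : Mat r} → (∀ i j → (N · M) i j ≡ idMat i j) → ∀ a i → mulVec N (mulVec M a) i ≡ a i
mulVec-inverse {r} {N} {M} NM≗I a i =
  trans (xorSum-∧-assoc r r (N i) M a) (trans (xorSum-cong λ k → cong (_∧ a k) (NM≗I i k)) (xorSum-idMat r a i))

-- An even zero-sum set img u c is Σ dᵢ Xᵢ; reading Xᵢ(uₖ) as (M yₖ)ᵢ turns it into Σ (dᵀM)ⱼ Yⱼ,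
-- which agrees with img w c.
transfer : {S T : Subset n} {X Y : Fin r → Subset n} {u w : Fin m → Pt n} (M : Mat r) →
  Enumerates S u → Enumerates T w →
  (∀ Z → InE S Z → Σ (Fin r → Bool) λ d → comb X d ≐ Z) → (∀ j → InE T (Y j)) →
  (∀ k i → X i (u k) ≡ mulVec M (λ j → Y j (w k)) i) → u ⊑ᴬ w
transfer {r = r} {X = X} {Y} {u} {w} M u-enum w-enum X-spans Y∈E key c aff =
  Equivalence.to (InE-img⇔AffRel w (Enumerates.member w-enum) c) (InE-cong img≐ (InE-comb Y Y∈E d′))
  where
  img-c = Equivalence.from (InE-img⇔AffRel u (Enumerates.member u-enum) c) aff
  d = proj₁ (X-spans (img u c) img-c)
  d′ : Fin r → Bool
  d′ j = xorSum r (λ i → d i ∧ M i j)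
  coeffs : ∀ k → comb Y d′ (w k) ≡ c k
  coeffs k = begin
    comb Y d′ (w k)                                           ≡⟨ xorSum-∧-assoc r r d M (λ j → Y j (w k)) ⟨
    xorSum r (λ i → d i ∧ mulVec M (λ j → Y j (w k)) i)       ≡⟨ xorSum-cong (λ i → cong (d i ∧_) (key k i)) ⟨
    comb X d (u k)                                            ≡⟨ proj₂ (X-spans (img u c) img-c) (u k) ⟩
    img u c (u k)                                             ≡⟨ img-at u (Enumerates.injective u-enum) c k ⟩
    c k                                                       ∎
    where open ≡-Reasoning
  img≐ : comb Y d′ ≐ img w c
  img≐ y = trans (⊆⇒img w-enum (proj₁ (InE-comb Y Y∈E d′)) y) (img-cong w coeffs y)

signature : (X : Fin r → Subset n) → Pt n → Pt r
signature X x = tabulate (λ i → X i x)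

venn-signature : (S : Subset n) (X : Fin r → Subset n) (a : Fin r → Bool) →
  ∀ x → venn S X a x ≡ S x ∧ does (signature X x ≟ᵥ tabulate a)
venn-signature S X a x = cong (S x ∧_) (andAll-≟ (λ i → X i x) a)

venn-mulVec : {N M : Mat r} → (∀ i j → (N · M) i j ≡ idMat i j) → (∀ i j → (M · N) i j ≡ idMat i j) →
  (T : Subset n) (Y : Fin r → Subset n) (a : Fin r → Bool) →
  ∀ t → venn T Y (mulVec N a) t ≡ T t ∧ does (tabulate (mulVec M (λ j → Y j t)) ≟ᵥ tabulate a)
venn-mulVec {N = N} {M} NM≗I MN≗I T Y a t = trans (venn-signature T Y (mulVec N a) t) (cong (T t ∧_)
  (does-⇔ (⇔-sym tabulate-≡⇔ ⇔-∘ (mk⇔ rotate unrotate ⇔-∘ tabulate-≡⇔)) (signature Y t ≟ᵥ _) (_ ≟ᵥ _)))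
  where
  y = λ j → Y j t
  rotate : (∀ j → y j ≡ mulVec N a j) → ∀ i → mulVec M y i ≡ a i
  rotate y≗Na i = trans (mulVec-cong M y≗Na i) (mulVec-inverse MN≗I a i)
  unrotate : (∀ i → mulVec M y i ≡ a i) → ∀ j → y j ≡ mulVec N a j
  unrotate My≗a j = trans (sym (mulVec-inverse NM≗I y j)) (mulVec-cong N My≗a j)

vennBij⇒matching : {S T : Subset n} → CardPresVennBij S T → AffineMatching S T
vennBij⇒matching {n} {S} {T} (r , X , Y , N , X-basis , Y-basis , (M , NM≗I , MN≗I) , cards) =
  let (size , u , w , u-enum , w-enum , σu≡τw) = fibre-matching _≟ᵥ_ (signature X) τ counts
      key : ∀ k i → X i (u k) ≡ mulVec M (λ j → Y j (w k)) i
      key k = Equivalence.to tabulate-≡⇔ (σu≡τw k)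
      key′ : ∀ k j → Y j (w k) ≡ mulVec N (λ i → X i (u k)) j
      key′ k j = trans (sym (mulVec-inverse NM≗I (λ j → Y j (w k)) j)) (mulVec-cong N (sym ∘ key k) j)
  in record
    { size = size ; u = u ; w = w ; u-enum = u-enum ; w-enum = w-enum
    ; u⊑w = transfer M u-enum w-enum (proj₂ (proj₂ X-basis)) (proj₁ Y-basis) key
    ; w⊑u = transfer N w-enum u-enum (proj₂ (proj₂ Y-basis)) (proj₁ X-basis) key′ }
  where
  τ : Pt n → Pt r
  τ t = tabulate (mulVec M (λ j → Y j t))
  fibreS fibreT : Pt r → ℕ
  fibreS κ = countL (elements S) (λ s → does (signature X s ≟ᵥ κ))
  fibreT κ = countL (elements T) (λ t → does (τ t ≟ᵥ κ))
  counts : ∀ κ → fibreS κ ≡ fibreT κ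
  counts κ = subst (λ κ → fibreS κ ≡ fibreT κ) (tabulate∘lookup κ) (begin
      fibreS (tabulate a)                                   ≡⟨ countL-elements S _ ⟩
      card (λ s → S s ∧ does (signature X s ≟ᵥ tabulate a))  ≡⟨ countL-cong (allPts n) (venn-signature S X a) ⟨
      card (venn S X a)                                     ≡⟨ cards a ⟨
      card (venn T Y (mulVec N a))                          ≡⟨ countL-cong (allPts n) (venn-mulVec NM≗I MN≗I T Y a) ⟩
      card (λ t → T t ∧ does (τ t ≟ᵥ tabulate a))           ≡⟨ countL-elements T _ ⟨
      fibreT (tabulate a)                                   ∎)
    where
    a = lookup κ
    open ≡-Reasoning

theorem5p7 : (n : ℕ) (S T : Subset n) →
    AffinelyEquivalent S T ⇔ CardPresVennBij S T
theorem5p7 n S T = mk⇔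
  (matching⇒vennBij ∘ affineImage⇒matching ∘ Equivalence.to affinelyEquivalent⇔affineImage)
  (Equivalence.from affinelyEquivalent⇔affineImage ∘ matching⇒affineImage ∘ vennBij⇒matching)
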